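{- Let $a,b,k$ be integers with $k\ge b>a\ge 1$. Let $\mathcal{D}_{a,b,k}$ be the set of partitions $(\pi_1,\dots,\pi_\ell)$ such that every $\pi_i\equiv a$ or $b\pmod k$, and for $1\le i<\ell$, $\pi_i-\pi_{i+1}\ge k$, with strict inequality if $\pi_i\equiv b\pmod k$. Then \[\sum_{\pi\in\mathcal{D}_{a,b,k}}u^{\ell_a(\pi)}v^{\ell_b(\pi)}q^{|\pi|}=\sum_{m\ge0}\frac{u^mq^{k\binom m2+ma}}{(q^k;q^k)_m}(-u^{ -1}vq^{b-a};q^k)_m=\sum_{h\ge 0}\frac{v^hq^{2k\binom h2+bh}}{(q^k;q^k)_h}(-uq^{kh+a};q^k)_\infty .\]
   Context: A partition is a finite non-increasing sequence of positive integers; $|\pi|$ is the sum of its parts (the empty partition is allowed). For a partition $\pi$, $\ell_a(\pi)$ and $\ell_b(\pi)$ denote the numbers of parts of $\pi$ congruent to $a$ and to $b$ modulo $k$, respectively. Throughout $|q|<1$; $(x;q)_\infty=\prod_{i\ge0}(1-xq^i)$ and $(x;q)_n=(x;q)_\infty/(xq^n;q)_\infty$. -}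

module Defs where

open import Data.Nat using (ℕ; zero; suc; _+_; _*_; _∸_; _≤_; _<_; NonZero)
open import Data.Nat.DivMod using (_%_)
open import Data.Nat.Combinatorics using (_C_)
import Data.Nat as ℕ
open import Data.Integer as ℤ using (ℤ; +_)
open import Data.List using (List; []; _∷_; length; filter; sum)
open import Data.Sum using (_⊎_)
open import Data.Product using (_×_)
open import Relation.Binary.PropositionalEquality using (_≡_)
open import Relation.Nullary.Decidable using (⌊_⌋)
open import Data.Bool using (if_then_else_)

module _ (a b k : ℕ) .{{_ : NonZero k}} where

  PartOK : ℕ → Set
  PartOK p = (1 ≤ p) × (p % k ≡ a % k ⊎ p % k ≡ b % k)

  GapOK : ℕ → ℕ → Set
  GapOK p r = r + k + (if ⌊ p % k ℕ.≟ b % k ⌋ then 1 else 0) ≤ p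

  data InD : List ℕ → Set where
    nil  : InD []
    one  : ∀ {p} → PartOK p → InD (p ∷ [])
    cons : ∀ {p r π} → PartOK p → GapOK p r → InD (r ∷ π) → InD (p ∷ r ∷ π)

  ℓa : List ℕ → ℕ
  ℓa π = length (filter (λ p → p % k ℕ.≟ a % k) π)

  ℓb : List ℕ → ℕ
  ℓb π = length (filter (λ p → p % k ℕ.≟ b % k) π)

-- Formal power series in u, v, q with integer coefficients:
-- S f i j n = coefficient of u^i v^j q^n

Ser : Set
Ser = ℕ → ℕ → ℕ → ℤ

Σ< : ℕ → (ℕ → ℤ) → ℤ
Σ< zero    f = + 0
Σ< (suc n) f = Σ< n f ℤ.+ f n

Σ≤ : ℕ → (ℕ → ℤ) → ℤ
Σ≤ n f = Σ< (suc n) f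

_⊕_ : Ser → Ser → Ser
(f ⊕ g) i j n = f i j n ℤ.+ g i j n

⊝_ : Ser → Ser
(⊝ f) i j n = ℤ.- f i j n

_⊗_ : Ser → Ser → Ser
(f ⊗ g) i j n =
  Σ≤ i λ i₁ → Σ≤ j λ j₁ → Σ≤ n λ n₁ →
    f i₁ j₁ n₁ ℤ.* g (i ∸ i₁) (j ∸ j₁) (n ∸ n₁)

infixl 6 _⊕_
infixl 7 _⊗_

mono : ℕ → ℕ → ℕ → Ser
mono i j n i' j' n' =
  if ⌊ i ℕ.≟ i' ⌋ then (if ⌊ j ℕ.≟ j' ⌋ then (if ⌊ n ℕ.≟ n' ⌋ then + 1 else + 0) else + 0) else + 0

𝟙 : Ser
𝟙 = mono 0 0 0

ΣS : ℕ → (ℕ → Ser) → Ser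
ΣS zero    f = λ _ _ _ → + 0
ΣS (suc m) f = ΣS m f ⊕ f m

ΠS : ℕ → (ℕ → Ser) → Ser
ΠS zero    f = 𝟙
ΠS (suc m) f = ΠS m f ⊗ f m

poch : Ser → ℕ → ℕ → Ser
poch x s m = ΠS m λ t → 𝟙 ⊕ ⊝ (x ⊗ mono 0 0 (s * t))

-- 1/(1 - q^s) = Σ_{t≥0} q^{s t}   (s ≥ 1)
geomInv : ℕ → Ser
geomInv s i j n with i | j
... | zero | zero = if ⌊ n % suc (s ∸ 1) ℕ.≟ 0 ⌋ then + 1 else + 0
... | _    | _    = + 0

invQPoch : ℕ → ℕ → Ser
invQPoch k m = ΠS m λ t → geomInv (k * suc t)

module _ (a b k : ℕ) where

  -- u^m q^{k C(m,2) + m a} / (q^k;q^k)_m · (-u^{-1} v q^{b-a}; q^k)_m,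
  -- where u^m (-u^{-1} v q^{b-a}; q^k)_m is the polynomial Π_{t<m} (u + v q^{b-a+kt})
  midTerm : ℕ → Ser
  midTerm m = mono 0 0 (k * (m C 2) + m * a) ⊗ invQPoch k m
              ⊗ ΠS m (λ t → mono 1 0 0 ⊕ mono 0 1 (b ∸ a + k * t))

  midPartial : ℕ → Ser
  midPartial M = ΣS M midTerm

  -- v^h q^{2k C(h,2) + b h} / (q^k;q^k)_h · (-u q^{kh+a}; q^k)_M   (M-th truncation of the product)
  rightTerm : ℕ → ℕ → Ser
  rightTerm M h = mono 0 h (2 * k * (h C 2) + b * h) ⊗ invQPoch k h
                  ⊗ poch (⊝ mono 1 0 (k * h + a)) k M

  rightPartial : ℕ → Ser
  rightPartial M = ΣS M (rightTerm M)

{-# OPTIONS --safe #-}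

-- Both series have, as coefficient of u^i v^j, the q-series
--   coeff i j = q^(k C(i,2) + 2k C(j,2) + ijk + ia + jb) / ((q^k;q^k)_i (q^k;q^k)_j).
-- In the middle sum only the term m = i + j contributes, and the q-binomial theorem evaluates its
-- elementary symmetric function of q^(b-a), q^(b-a+k), …, q^(b-a+k(m-1)); in the right sum only h = j
-- contributes, and its truncated product (-u q^(kj+a); q^k)_M is exact in all q-degrees below M - i.
-- The series satisfy
--   coeff i j = q^((i+j)k) coeff i j + [i > 0] q^(a+(i+j-1)k) coeff (i-1) j + [j > 0] q^(b+2(i+j-1)k) coeff i (j-1),
-- mirroring a decomposition of the partitions in D by their smallest part: if it is neither a nor b, all
-- parts exceed k and subtracting k from each leaves a partition in D; if it is a (resp. b), removing it and
-- subtracting k (resp. 2k) from the other parts does. Strong induction on the size n then shows that the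
-- q^n-coefficient of coeff i j counts the partitions in D with i parts ≡ a, j parts ≡ b (mod k) and size n.
module Submission where

open import Defs
open import Data.Nat as ℕ using (ℕ; zero; suc; _∸_; _≤_; _<_; z≤n; s≤s; NonZero)
import Data.Nat.Properties as ℕₚ
open import Data.Nat.Combinatorics using (_C_; nCk+nC[k+1]≡[n+1]C[k+1]; nC1≡n)
open import Data.Nat.DivMod using (_%_; _/_; m≡m%n+[m/n]*n; [m+n]%n≡m%n; m<n⇒m%n≡m; %-remove-+ˡ)
open import Data.Nat.Divisibility using (_∣_; ∣-refl; ∣m∣n⇒∣m+n)
open import Data.Nat.Induction using (<-rec)
open import Data.Nat.ListAction using (sum)
import Data.Nat.ListAction.Properties as sumₚ
open import Data.Nat.Tactic.RingSolver using (solve-∀)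
import Data.Integer as ℤ
import Data.Integer.Properties as ℤₚ
open import Data.List using (List; []; _∷_; _++_; _∷ʳ_; map; length; filter)
import Data.List.Properties as Listₚ
open import Data.List.Relation.Unary.All as All using (All; []; _∷_)
import Data.List.Relation.Unary.All.Properties as Allₚ
open import Data.Fin as Fin using (Fin)
import Data.Fin.Properties as Finₚ
open import Data.Bool using (if_then_else_)
open import Data.Empty using (⊥)
open import Data.Unit using (⊤; tt)
open import Data.Maybe using (Maybe; just; nothing)
open import Data.Product using (Σ; ∃; _×_; _,_; proj₁; proj₂)
open import Data.Sum as Sum using (_⊎_; inj₁; inj₂)
open import Data.Sum.Function.Propositional using (_⊎-↔_)
open import Function using (_∘_)
open import Function.Bundles using (_↔_; mk↔ₛ′)
open import Function.Construct.Composition using (_↔-∘_)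
open import Function.Construct.Identity using (↔-id)
open import Function.Construct.Symmetry using (↔-sym)
open import Function.Related.TypeIsomorphisms using (Σ-distribʳ-⊎)
open import Level using (0ℓ)
open import Relation.Binary.PropositionalEquality
open import Relation.Binary.Definitions using (tri<; tri≈; tri>)
open import Relation.Nullary using (¬_; yes; no; contradiction; Irrelevant; Dec)
open import Relation.Nullary.Decidable using (⌊_⌋; _×-dec_)
open import Algebra.Bundles using (CommutativeRing)
open import Algebra.Solver.Ring.AlmostCommutativeRing
  using (AlmostCommutativeRing; fromCommutativeRing; _-Raw-AlmostCommutative⟶_)
import Algebra.Solver.Ring
import Relation.Binary.Reasoning.Setoid as SetoidReasoning

C2-suc : ∀ n → suc n C 2 ≡ n ℕ.+ n C 2
C2-suc n = trans (sym (nCk+nC[k+1]≡[n+1]C[k+1] n 1)) (cong (ℕ._+ n C 2) (nC1≡n n))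

C2-+ : ∀ i j → (i ℕ.+ j) C 2 ≡ i C 2 ℕ.+ j C 2 ℕ.+ i ℕ.* j
C2-+ zero    j = sym (ℕₚ.+-identityʳ (j C 2))
C2-+ (suc i) j rewrite C2-suc (i ℕ.+ j) | C2-+ i j | C2-suc i = arithmetic i j (i C 2) (j C 2)
  where
  arithmetic : ∀ i j x y → i ℕ.+ j ℕ.+ (x ℕ.+ y ℕ.+ i ℕ.* j) ≡ i ℕ.+ x ℕ.+ y ℕ.+ suc i ℕ.* j
  arithmetic = solve-∀

module FiniteSums where

  open ℤ using (ℤ; +_; _+_; _*_; -_)

  Σ<-cong< : ∀ n {f g : ℕ → ℤ} → (∀ t → t < n → f t ≡ g t) → Σ< n f ≡ Σ< n g
  Σ<-cong< zero    f≗g = refl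
  Σ<-cong< (suc n) f≗g = cong₂ _+_ (Σ<-cong< n (λ t t<n → f≗g t (ℕₚ.m<n⇒m<1+n t<n))) (f≗g n ℕₚ.≤-refl)

  Σ<-cong : ∀ n {f g : ℕ → ℤ} → (∀ t → f t ≡ g t) → Σ< n f ≡ Σ< n g
  Σ<-cong n f≗g = Σ<-cong< n (λ t _ → f≗g t)

  Σ<-zero : ∀ n {f : ℕ → ℤ} → (∀ t → t < n → f t ≡ + 0) → Σ< n f ≡ + 0
  Σ<-zero zero    f≗0 = refl
  Σ<-zero (suc n) f≗0 = cong₂ _+_ (Σ<-zero n (λ t t<n → f≗0 t (ℕₚ.m<n⇒m<1+n t<n))) (f≗0 n ℕₚ.≤-refl)

  Σ<-distrib-+ : ∀ n (f g : ℕ → ℤ) → Σ< n (λ t → f t + g t) ≡ Σ< n f + Σ< n g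
  Σ<-distrib-+ zero    f g = refl
  Σ<-distrib-+ (suc n) f g = begin
    Σ< n (λ t → f t + g t) + (f n + g n)  ≡⟨ cong (_+ (f n + g n)) (Σ<-distrib-+ n f g) ⟩
    Σ< n f + Σ< n g + (f n + g n)         ≡⟨ ℤₚ.+-assoc (Σ< n f) (Σ< n g) _ ⟩
    Σ< n f + (Σ< n g + (f n + g n))       ≡⟨ cong (_+_ (Σ< n f)) (ℤₚ.+-comm (Σ< n g) _) ⟩
    Σ< n f + ((f n + g n) + Σ< n g)       ≡⟨ cong (_+_ (Σ< n f)) (ℤₚ.+-assoc (f n) (g n) _) ⟩
    Σ< n f + (f n + (g n + Σ< n g))       ≡⟨ ℤₚ.+-assoc (Σ< n f) (f n) _ ⟨
    Σ< n f + f n + (g n + Σ< n g)         ≡⟨ cong (_+_ (Σ< n f + f n)) (ℤₚ.+-comm (g n) _) ⟩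
    Σ< n f + f n + (Σ< n g + g n)         ∎
    where open ≡-Reasoning

  *-distribˡ-Σ< : ∀ n c (f : ℕ → ℤ) → c * Σ< n f ≡ Σ< n (λ t → c * f t)
  *-distribˡ-Σ< zero    c f = ℤₚ.*-zeroʳ c
  *-distribˡ-Σ< (suc n) c f =
    trans (ℤₚ.*-distribˡ-+ c (Σ< n f) (f n)) (cong (_+ c * f n) (*-distribˡ-Σ< n c f))

  *-distribʳ-Σ< : ∀ n c (f : ℕ → ℤ) → Σ< n f * c ≡ Σ< n (λ t → f t * c)
  *-distribʳ-Σ< n c f = trans (ℤₚ.*-comm (Σ< n f) c)
    (trans (*-distribˡ-Σ< n c f) (Σ<-cong n (λ t → ℤₚ.*-comm c (f t))))

  neg-distrib-Σ< : ∀ n (f : ℕ → ℤ) → - Σ< n f ≡ Σ< n (λ t → - f t)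
  neg-distrib-Σ< zero    f = refl
  neg-distrib-Σ< (suc n) f =
    trans (ℤₚ.neg-distrib-+ (Σ< n f) (f n)) (cong (_+ - f n) (neg-distrib-Σ< n f))

  Σ<-suc : ∀ n (f : ℕ → ℤ) → Σ< (suc n) f ≡ f 0 + Σ< n (λ t → f (suc t))
  Σ<-suc zero    f = trans (ℤₚ.+-identityˡ (f 0)) (sym (ℤₚ.+-identityʳ (f 0)))
  Σ<-suc (suc n) f = trans (cong (_+ f (suc n)) (Σ<-suc n f)) (ℤₚ.+-assoc (f 0) _ _)

  Σ<-single : ∀ n (f : ℕ → ℤ) t₀ → t₀ < n → (∀ t → t < n → ¬ t ≡ t₀ → f t ≡ + 0) → Σ< n f ≡ f t₀
  Σ<-single (suc n) f t₀ t₀<1+n f≗0 with t₀ ℕ.≟ n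
  ... | yes refl = trans (cong (_+ f t₀) (Σ<-zero n (λ t t<n → f≗0 t (ℕₚ.m<n⇒m<1+n t<n) (ℕₚ.<⇒≢ t<n))))
                         (ℤₚ.+-identityˡ (f t₀))
  ... | no t₀≢n  = trans (cong₂ _+_ (Σ<-single n f t₀ t₀<n (λ t t<n → f≗0 t (ℕₚ.m<n⇒m<1+n t<n)))
                                    (f≗0 n ℕₚ.≤-refl (t₀≢n ∘ sym)))
                         (ℤₚ.+-identityʳ (f t₀))
    where
    t₀<n : t₀ < n
    t₀<n = ℕₚ.≤∧≢⇒< (ℕₚ.≤-pred t₀<1+n) t₀≢n

  Σ≤-reverse : ∀ n (f : ℕ → ℤ) → Σ≤ n f ≡ Σ≤ n (λ t → f (n ∸ t))
  Σ≤-reverse zero    f = refl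
  Σ≤-reverse (suc n) f = begin
    Σ≤ n f + f (suc n)                      ≡⟨ cong (_+ f (suc n)) (Σ≤-reverse n f) ⟩
    Σ≤ n (λ t → f (n ∸ t)) + f (suc n)      ≡⟨ ℤₚ.+-comm _ (f (suc n)) ⟩
    f (suc n) + Σ≤ n (λ t → f (n ∸ t))      ≡⟨ Σ<-suc (suc n) (λ t → f (suc n ∸ t)) ⟨
    Σ≤ (suc n) (λ t → f (suc n ∸ t))        ∎
    where open ≡-Reasoning

  Σ≤-triangle : ∀ n (f : ℕ → ℕ → ℤ) →
    Σ≤ n (λ s → Σ≤ s (λ t → f s t)) ≡ Σ≤ n (λ t → Σ≤ (n ∸ t) (λ r → f (t ℕ.+ r) t))
  Σ≤-triangle zero    f = refl
  Σ≤-triangle (suc n) f = begin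
    Σ≤ n (λ s → Σ≤ s (f s)) + (Σ≤ n (f (suc n)) + f (suc n) (suc n))
      ≡⟨ cong (_+ (Σ≤ n (f (suc n)) + f (suc n) (suc n))) (Σ≤-triangle n f) ⟩
    Σ≤ n (λ t → Σ≤ (n ∸ t) (column t)) + (Σ≤ n (f (suc n)) + f (suc n) (suc n))
      ≡⟨ ℤₚ.+-assoc (Σ≤ n (λ t → Σ≤ (n ∸ t) (column t))) _ _ ⟨
    Σ≤ n (λ t → Σ≤ (n ∸ t) (column t)) + Σ≤ n (f (suc n)) + f (suc n) (suc n)
      ≡⟨ cong₂ _+_ (sym (Σ<-distrib-+ (suc n) _ _)) (sym lastColumn) ⟩
    Σ≤ n (λ t → Σ≤ (n ∸ t) (column t) + f (suc n) t) + Σ≤ (suc n ∸ suc n) (column (suc n))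
      ≡⟨ cong (_+ Σ≤ (suc n ∸ suc n) (column (suc n))) (Σ<-cong< (suc n) extendColumn) ⟩
    Σ≤ n (λ t → Σ≤ (suc n ∸ t) (column t)) + Σ≤ (suc n ∸ suc n) (column (suc n)) ∎
    where
    open ≡-Reasoning
    column : ℕ → ℕ → ℤ
    column t r = f (t ℕ.+ r) t
    lastColumn : Σ≤ (suc n ∸ suc n) (column (suc n)) ≡ f (suc n) (suc n)
    lastColumn rewrite ℕₚ.n∸n≡0 n | ℕₚ.+-identityʳ n = ℤₚ.+-identityˡ _
    extendColumn : ∀ t → t < suc n → Σ≤ (n ∸ t) (column t) + f (suc n) t ≡ Σ≤ (suc n ∸ t) (column t)
    extendColumn t (s≤s t≤n) rewrite ℕₚ.+-∸-assoc 1 t≤n | ℕₚ.+-suc t (n ∸ t) | ℕₚ.m+[n∸m]≡n t≤n = refl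

  Σ≤²-single : ∀ m n (f : ℕ → ℕ → ℤ) s₀ t₀ → s₀ ≤ m → t₀ ≤ n →
    (∀ s t → s ≤ m → t ≤ n → ¬ (s ≡ s₀ × t ≡ t₀) → f s t ≡ + 0) →
    Σ≤ m (λ s → Σ≤ n (f s)) ≡ f s₀ t₀
  Σ≤²-single m n f s₀ t₀ s₀≤m t₀≤n f≗0 =
    trans (Σ<-single (suc m) (λ s → Σ≤ n (f s)) s₀ (s≤s s₀≤m)
            (λ s s≤m s≢s₀ → Σ<-zero (suc n) (λ t t≤n →
               f≗0 s t (ℕₚ.≤-pred s≤m) (ℕₚ.≤-pred t≤n) (s≢s₀ ∘ proj₁))))
          (Σ<-single (suc n) (f s₀) t₀ (s≤s t₀≤n)
            (λ t t≤n t≢t₀ → f≗0 s₀ t s₀≤m (ℕₚ.≤-pred t≤n) (t≢t₀ ∘ proj₂)))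

  Σ≤²-zero : ∀ m n (f : ℕ → ℕ → ℤ) → (∀ s t → s ≤ m → t ≤ n → f s t ≡ + 0) →
    Σ≤ m (λ s → Σ≤ n (f s)) ≡ + 0
  Σ≤²-zero m n f f≗0 =
    Σ<-zero (suc m) (λ s s≤m → Σ<-zero (suc n) (λ t t≤n → f≗0 s t (ℕₚ.≤-pred s≤m) (ℕₚ.≤-pred t≤n)))

open FiniteSums

module PowerSeries where

  open ℤ using (ℤ; +_; _+_; _-_; _*_; -_; _≟_)

  ℤ[[q]] : Set
  ℤ[[q]] = ℕ → ℤ

  infix 4 _≋_
  record _≋_ (A B : ℤ[[q]]) : Set where
    constructor mk≋
    field at : ∀ n → A n ≡ B n
  open _≋_ public

  infixl 6 _⊞_
  infixl 7 _⊠_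
  infix 8 ⊟_ 1-_
  infix 9 q^_

  _⊞_ : ℤ[[q]] → ℤ[[q]] → ℤ[[q]]
  (A ⊞ B) n = A n + B n

  _⊠_ : ℤ[[q]] → ℤ[[q]] → ℤ[[q]]
  (A ⊠ B) n = Σ≤ n (λ t → A t * B (n ∸ t))

  ⊟_ : ℤ[[q]] → ℤ[[q]]
  (⊟ A) n = - A n

  𝟘 : ℤ[[q]]
  𝟘 n = + 0

  const : ℤ → ℤ[[q]]
  const z zero    = z
  const z (suc n) = + 0

  -- A constant series rather than q^ 0, so that the ring solver's [con (+ 1)] denotes it.
  𝟏 : ℤ[[q]]
  𝟏 = const (+ 1)

  q^_ : ℕ → ℤ[[q]]
  (q^ s) n = if ⌊ s ℕ.≟ n ⌋ then + 1 else + 0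

  1-_ : ℤ[[q]] → ℤ[[q]]
  1- A = 𝟏 ⊞ ⊟ A

  𝟏-suc : ∀ {n} → 0 < n → 𝟏 n ≡ + 0
  𝟏-suc {suc n} _ = refl

  q^0≋𝟏 : q^ 0 ≋ 𝟏
  q^0≋𝟏 = mk≋ λ { zero → refl ; (suc n) → refl }

  q^-diag : ∀ s → (q^ s) s ≡ + 1
  q^-diag s with s ℕ.≟ s
  ... | yes _   = refl
  ... | no  s≢s = contradiction refl s≢s

  q^-off : ∀ s n → ¬ s ≡ n → (q^ s) n ≡ + 0
  q^-off s n s≢n with s ℕ.≟ n
  ... | yes s≡n = contradiction s≡n s≢n
  ... | no  _   = refl

  ≋-refl : ∀ {A} → A ≋ A
  ≋-refl = mk≋ (λ _ → refl)

  ≋-sym : ∀ {A B} → A ≋ B → B ≋ A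
  ≋-sym A≋B = mk≋ (λ n → sym (at A≋B n))

  ≋-trans : ∀ {A B C} → A ≋ B → B ≋ C → A ≋ C
  ≋-trans A≋B B≋C = mk≋ (λ n → trans (at A≋B n) (at B≋C n))

  ⊞-cong : ∀ {A A′ B B′} → A ≋ A′ → B ≋ B′ → A ⊞ B ≋ A′ ⊞ B′
  ⊞-cong A≋A′ B≋B′ = mk≋ (λ n → cong₂ _+_ (at A≋A′ n) (at B≋B′ n))

  ⊟-cong : ∀ {A B} → A ≋ B → ⊟ A ≋ ⊟ B
  ⊟-cong A≋B = mk≋ λ n → cong -_ (at A≋B n)

  ⊠-cong : ∀ {A A′ B B′} → A ≋ A′ → B ≋ B′ → A ⊠ B ≋ A′ ⊠ B′
  ⊠-cong A≋A′ B≋B′ = mk≋ (λ n → Σ<-cong (suc n) (λ t → cong₂ _*_ (at A≋A′ t) (at B≋B′ (n ∸ t))))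

  ⊞-identityˡ : ∀ A → 𝟘 ⊞ A ≋ A
  ⊞-identityˡ A = mk≋ λ n → ℤₚ.+-identityˡ (A n)

  ⊞-identityʳ : ∀ A → A ⊞ 𝟘 ≋ A
  ⊞-identityʳ A = mk≋ λ n → ℤₚ.+-identityʳ (A n)

  ⊠-comm : ∀ A B → A ⊠ B ≋ B ⊠ A
  ⊠-comm A B = mk≋ λ n → trans (Σ≤-reverse n (λ t → A t * B (n ∸ t)))
    (Σ<-cong< (suc n) (λ t t≤n → trans (ℤₚ.*-comm (A (n ∸ t)) (B (n ∸ (n ∸ t))))
       (cong (λ m → B m * A (n ∸ t)) (ℕₚ.m∸[m∸n]≡n (ℕₚ.≤-pred t≤n)))))

  ⊠-assoc : ∀ A B C → (A ⊠ B) ⊠ C ≋ A ⊠ (B ⊠ C)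
  ⊠-assoc A B C = mk≋ coefficient
    where
    coefficient : ∀ n → ((A ⊠ B) ⊠ C) n ≡ (A ⊠ (B ⊠ C)) n
    coefficient n = begin
      Σ≤ n (λ s → Σ≤ s (λ t → A t * B (s ∸ t)) * C (n ∸ s))
        ≡⟨ Σ<-cong (suc n) (λ s → *-distribʳ-Σ< (suc s) (C (n ∸ s)) (λ t → A t * B (s ∸ t))) ⟩
      Σ≤ n (λ s → Σ≤ s (λ t → A t * B (s ∸ t) * C (n ∸ s)))
        ≡⟨ Σ≤-triangle n (λ s t → A t * B (s ∸ t) * C (n ∸ s)) ⟩
      Σ≤ n (λ t → Σ≤ (n ∸ t) (λ r → A t * B (t ℕ.+ r ∸ t) * C (n ∸ (t ℕ.+ r))))
        ≡⟨ Σ<-cong (suc n) (λ t → Σ<-cong (suc (n ∸ t)) (reindex t)) ⟩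
      Σ≤ n (λ t → Σ≤ (n ∸ t) (λ r → A t * (B r * C (n ∸ t ∸ r))))
        ≡⟨ Σ<-cong (suc n) (λ t → *-distribˡ-Σ< (suc (n ∸ t)) (A t) (λ r → B r * C (n ∸ t ∸ r))) ⟨
      Σ≤ n (λ t → A t * Σ≤ (n ∸ t) (λ r → B r * C (n ∸ t ∸ r))) ∎
      where
      open ≡-Reasoning
      reindex : ∀ t r → A t * B (t ℕ.+ r ∸ t) * C (n ∸ (t ℕ.+ r)) ≡ A t * (B r * C (n ∸ t ∸ r))
      reindex t r rewrite ℕₚ.m+n∸m≡n t r | ℕₚ.∸-+-assoc n t r = ℤₚ.*-assoc (A t) (B r) (C (n ∸ (t ℕ.+ r)))

  ⊠-distribˡ-⊞ : ∀ A B C → A ⊠ (B ⊞ C) ≋ A ⊠ B ⊞ A ⊠ C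
  ⊠-distribˡ-⊞ A B C = mk≋ λ n →
    trans (Σ<-cong (suc n) (λ t → ℤₚ.*-distribˡ-+ (A t) (B (n ∸ t)) (C (n ∸ t))))
          (Σ<-distrib-+ (suc n) (λ t → A t * B (n ∸ t)) (λ t → A t * C (n ∸ t)))

  ⊠-distribʳ-⊞ : ∀ A B C → (B ⊞ C) ⊠ A ≋ B ⊠ A ⊞ C ⊠ A
  ⊠-distribʳ-⊞ A B C =
    ≋-trans (⊠-comm (B ⊞ C) A) (≋-trans (⊠-distribˡ-⊞ A B C) (⊞-cong (⊠-comm A B) (⊠-comm A C)))

  ⊠-identityˡ : ∀ A → 𝟏 ⊠ A ≋ A
  ⊠-identityˡ A = mk≋ λ n → trans (Σ<-suc n (λ t → 𝟏 t * A (n ∸ t)))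
    (trans (cong₂ _+_ (ℤₚ.*-identityˡ (A n)) (Σ<-zero n (λ _ _ → refl))) (ℤₚ.+-identityʳ (A n)))

  ⊠-identityʳ : ∀ A → A ⊠ 𝟏 ≋ A
  ⊠-identityʳ A = ≋-trans (⊠-comm A 𝟏) (⊠-identityˡ A)

  ℤ[[q]]-commutativeRing : CommutativeRing 0ℓ 0ℓ
  ℤ[[q]]-commutativeRing = record
    { Carrier = ℤ[[q]] ; _≈_ = _≋_ ; _+_ = _⊞_ ; _*_ = _⊠_ ; -_ = ⊟_ ; 0# = 𝟘 ; 1# = 𝟏
    ; isCommutativeRing = record
      { isRing = record
        { +-isAbelianGroup = record
          { isGroup = record
            { isMonoid = record
              { isSemigroup = record
                { isMagma = record
                  { isEquivalence = record { refl = ≋-refl ; sym = ≋-sym ; trans = ≋-trans }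
                  ; ∙-cong = ⊞-cong }
                ; assoc = λ A B C → mk≋ λ n → ℤₚ.+-assoc (A n) (B n) (C n) }
              ; identity = ⊞-identityˡ , ⊞-identityʳ }
            ; inverse = (λ A → mk≋ λ n → ℤₚ.+-inverseˡ (A n)) , (λ A → mk≋ λ n → ℤₚ.+-inverseʳ (A n))
            ; ⁻¹-cong = ⊟-cong }
          ; comm = λ A B → mk≋ λ n → ℤₚ.+-comm (A n) (B n) }
        ; *-cong = ⊠-cong
        ; *-assoc = ⊠-assoc
        ; *-identity = ⊠-identityˡ , ⊠-identityʳ
        ; distrib = ⊠-distribˡ-⊞ , ⊠-distribʳ-⊞ }
      ; *-comm = ⊠-comm } }

  private
    ℤ[[q]]-almostCommutativeRing : AlmostCommutativeRing 0ℓ 0ℓ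
    ℤ[[q]]-almostCommutativeRing = fromCommutativeRing ℤ[[q]]-commutativeRing

    const-suc-⊠ : ∀ z w n → (const z ⊠ const w) (suc n) ≡ + 0
    const-suc-⊠ z w n = begin
      (const z ⊠ const w) (suc n)                   ≡⟨ Σ<-suc (suc n) (λ t → const z t * const w (suc n ∸ t)) ⟩
      z * + 0 + Σ≤ n (λ t → + 0 * const w (n ∸ t))  ≡⟨ cong₂ _+_ (ℤₚ.*-zeroʳ z) (Σ<-zero (suc n) (λ _ _ → refl)) ⟩
      + 0                                           ∎
      where open ≡-Reasoning

    const-homomorphism : CommutativeRing.rawRing ℤₚ.+-*-commutativeRing
                         -Raw-AlmostCommutative⟶ ℤ[[q]]-almostCommutativeRing
    const-homomorphism = record
      { ⟦_⟧    = const
      ; +-homo = λ z w → mk≋ λ { zero → refl ; (suc n) → refl }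
      ; *-homo = λ z w → mk≋ λ { zero → sym (ℤₚ.+-identityˡ (z * w)) ; (suc n) → sym (const-suc-⊠ z w n) }
      ; -‿homo = λ z → mk≋ λ { zero → refl ; (suc n) → refl }
      ; 0-homo = mk≋ λ { zero → refl ; (suc n) → refl }
      ; 1-homo = mk≋ λ { zero → refl ; (suc n) → refl }
      }

    const-≟ : ∀ z w → Maybe (const z ≋ const w)
    const-≟ z w with z ≟ w
    ... | yes refl = just ≋-refl
    ... | no _     = nothing

  open Algebra.Solver.Ring (CommutativeRing.rawRing ℤₚ.+-*-commutativeRing)
    ℤ[[q]]-almostCommutativeRing const-homomorphism const-≟
    public using (solve; _:=_; _:+_; _:*_; _:-_; :-_; con)

  module ≋-Reasoning = SetoidReasoning (CommutativeRing.setoid ℤ[[q]]-commutativeRing)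

  ⊠-congˡ : ∀ {A A′} B → A ≋ A′ → A ⊠ B ≋ A′ ⊠ B
  ⊠-congˡ B A≋A′ = ⊠-cong A≋A′ (≋-refl {B})

  ⊠-congʳ : ∀ A {B B′} → B ≋ B′ → A ⊠ B ≋ A ⊠ B′
  ⊠-congʳ A B≋B′ = ⊠-cong (≋-refl {A}) B≋B′

  ⊞-congˡ : ∀ {A A′} B → A ≋ A′ → A ⊞ B ≋ A′ ⊞ B
  ⊞-congˡ B A≋A′ = ⊞-cong A≋A′ (≋-refl {B})

  ⊞-congʳ : ∀ A {B B′} → B ≋ B′ → A ⊞ B ≋ A ⊞ B′
  ⊞-congʳ A B≋B′ = ⊞-cong (≋-refl {A}) B≋B′

  ⊠-zeroʳ : ∀ A → A ⊠ 𝟘 ≋ 𝟘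
  ⊠-zeroʳ A = mk≋ (λ n → Σ<-zero (suc n) (λ t _ → ℤₚ.*-zeroʳ (A t)))

  ⊠-zeroˡ : ∀ A → 𝟘 ⊠ A ≋ 𝟘
  ⊠-zeroˡ A = ≋-trans (⊠-comm 𝟘 A) (⊠-zeroʳ A)

  ⊟-⊠ : ∀ A B → ⊟ A ⊠ B ≋ ⊟ (A ⊠ B)
  ⊟-⊠ A B = mk≋ λ n → trans (Σ<-cong (suc n) (λ t → sym (ℤₚ.neg-distribˡ-* (A t) (B (n ∸ t)))))
                             (sym (neg-distrib-Σ< (suc n) (λ t → A t * B (n ∸ t))))

  q^-cong : ∀ {s t} → s ≡ t → q^ s ≋ q^ t
  q^-cong refl = ≋-refl

  q^-shift : ∀ s A n → s ≤ n → (q^ s ⊠ A) n ≡ A (n ∸ s)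
  q^-shift s A n s≤n =
    trans (Σ<-single (suc n) (λ t → (q^ s) t * A (n ∸ t)) s (s≤s s≤n)
                     (λ t _ t≢s → cong (_* A (n ∸ t)) (q^-off s t (t≢s ∘ sym))))
          (trans (cong (_* A (n ∸ s)) (q^-diag s)) (ℤₚ.*-identityˡ (A (n ∸ s))))

  q^-shift-< : ∀ s A n → n < s → (q^ s ⊠ A) n ≡ + 0
  q^-shift-< s A n n<s = Σ<-zero (suc n) (λ t t≤n → cong (_* A (n ∸ t))
    (q^-off s t (λ { refl → ℕₚ.<⇒≱ n<s (ℕₚ.≤-pred t≤n) })))

  q^0-identityˡ : ∀ A → q^ 0 ⊠ A ≋ A
  q^0-identityˡ A = ≋-trans (⊠-congˡ A q^0≋𝟏) (⊠-identityˡ A)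

  q^-+ : ∀ s t → q^ s ⊠ q^ t ≋ q^ (s ℕ.+ t)
  q^-+ s t = mk≋ coefficient
    where
    coefficient : ∀ n → (q^ s ⊠ q^ t) n ≡ (q^ (s ℕ.+ t)) n
    coefficient n with s ℕ.≤? n
    ... | no s≰n = trans (q^-shift-< s (q^ t) n (ℕₚ.≰⇒> s≰n))
                         (sym (q^-off (s ℕ.+ t) n λ { refl → s≰n (ℕₚ.m≤m+n s t) }))
    ... | yes s≤n with t ℕ.≟ n ∸ s
    ...   | yes refl = begin
      (q^ s ⊠ q^ (n ∸ s)) n       ≡⟨ q^-shift s (q^ (n ∸ s)) n s≤n ⟩
      (q^ (n ∸ s)) (n ∸ s)        ≡⟨ q^-diag (n ∸ s) ⟩
      + 1                         ≡⟨ q^-diag (s ℕ.+ (n ∸ s)) ⟨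
      (q^ (s ℕ.+ (n ∸ s))) (s ℕ.+ (n ∸ s))  ≡⟨ cong (q^ (s ℕ.+ (n ∸ s))) (ℕₚ.m+[n∸m]≡n s≤n) ⟩
      (q^ (s ℕ.+ (n ∸ s))) n      ∎
      where open ≡-Reasoning
    ...   | no t≢n∸s = trans (q^-shift s (q^ t) n s≤n)
                        (trans (q^-off t (n ∸ s) t≢n∸s)
                               (sym (q^-off (s ℕ.+ t) n λ { refl → t≢n∸s (sym (ℕₚ.m+n∸m≡n s t)) })))

  q^-+-≡ : ∀ s t {u} → s ℕ.+ t ≡ u → q^ s ⊠ q^ t ≋ q^ u
  q^-+-≡ s t refl = q^-+ s t

  q^-split : ∀ {e} s t → e ≡ s ℕ.+ t → ∀ P Q → q^ e ⊠ P ⊠ Q ≋ q^ s ⊠ (q^ t ⊠ P ⊠ Q)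
  q^-split s t refl P Q = begin
    q^ (s ℕ.+ t) ⊠ P ⊠ Q   ≈⟨ ⊠-congˡ Q (⊠-congˡ P (q^-+ s t)) ⟨
    q^ s ⊠ q^ t ⊠ P ⊠ Q    ≈⟨ solve 4 (λ S T P Q → S :* T :* P :* Q := S :* (T :* P :* Q)) ≋-refl (q^ s) (q^ t) P Q ⟩
    q^ s ⊠ (q^ t ⊠ P ⊠ Q)  ∎
    where open ≋-Reasoning

  ⊠-1-q^ : ∀ s A n → (A ⊠ 1- q^ s) n ≡ A n - (q^ s ⊠ A) n
  ⊠-1-q^ s A n = begin
    (A ⊠ 1- q^ s) n             ≡⟨ at (⊠-distribˡ-⊞ A 𝟏 (⊟ q^ s)) n ⟩
    (A ⊠ 𝟏) n + (A ⊠ ⊟ q^ s) n  ≡⟨ cong₂ _+_ (at (⊠-identityʳ A) n)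
                                             (at (≋-trans (⊠-comm A (⊟ q^ s)) (⊟-⊠ (q^ s) A)) n) ⟩
    A n - (q^ s ⊠ A) n          ∎
    where open ≡-Reasoning

  AgreeBelow : ℕ → ℤ[[q]] → ℤ[[q]] → Set
  AgreeBelow d A B = ∀ n → n < d → A n ≡ B n

  ⊠-agreeBelow : ∀ {d} A {B B′} → AgreeBelow d B B′ → AgreeBelow d (A ⊠ B) (A ⊠ B′)
  ⊠-agreeBelow A B≈B′ n n<d =
    Σ<-cong< (suc n) (λ t _ → cong (A t *_) (B≈B′ (n ∸ t) (ℕₚ.≤-<-trans (ℕₚ.m∸n≤m n t) n<d)))

  ⊠-1-q^-agreeBelow : ∀ s A → AgreeBelow s (A ⊠ 1- q^ s) A
  ⊠-1-q^-agreeBelow s A n n<s = begin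
    (A ⊠ 1- q^ s) n     ≡⟨ ⊠-1-q^ s A n ⟩
    A n - (q^ s ⊠ A) n  ≡⟨ cong (_-_ (A n)) (q^-shift-< s A n n<s) ⟩
    A n - + 0           ≡⟨ ℤₚ.+-identityʳ (A n) ⟩
    A n                 ∎
    where open ≡-Reasoning

  geometric : ℕ → ℤ[[q]]
  geometric s n = geomInv s 0 0 n

  geometric-periodic : ∀ s n → suc s ≤ n → geometric (suc s) n ≡ geometric (suc s) (n ∸ suc s)
  geometric-periodic s n 1+s≤n = cong (λ r → if ⌊ r ℕ.≟ 0 ⌋ then + 1 else + 0)
    (trans (cong (_% suc s) (sym (ℕₚ.m∸n+n≡m 1+s≤n))) ([m+n]%n≡m%n (n ∸ suc s) (suc s)))

  geometric-initial : ∀ s n → n < suc s → geometric (suc s) n ≡ 𝟏 n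
  geometric-initial s n n≤s rewrite m<n⇒m%n≡m n≤s with n
  ... | zero  = refl
  ... | suc _ = refl

  geometric-inverse : ∀ s → geometric (suc s) ⊠ 1- q^ suc s ≋ 𝟏
  geometric-inverse s = mk≋ coefficient
    where
    G : ℤ[[q]]
    G = geometric (suc s)
    coefficient : ∀ n → (G ⊠ 1- q^ suc s) n ≡ 𝟏 n
    coefficient n with suc s ℕ.≤? n
    ... | yes 1+s≤n = begin
      (G ⊠ 1- q^ suc s) n            ≡⟨ ⊠-1-q^ (suc s) G n ⟩
      G n - (q^ suc s ⊠ G) n         ≡⟨ cong₂ _-_ (geometric-periodic s n 1+s≤n) (q^-shift (suc s) G n 1+s≤n) ⟩
      G (n ∸ suc s) - G (n ∸ suc s)  ≡⟨ ℤₚ.+-inverseʳ (G (n ∸ suc s)) ⟩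
      + 0                            ≡⟨ 𝟏-suc (ℕₚ.<-≤-trans (s≤s z≤n) 1+s≤n) ⟨
      𝟏 n                            ∎
      where open ≡-Reasoning
    ... | no 1+s≰n = trans (⊠-1-q^-agreeBelow (suc s) G n (ℕₚ.≰⇒> 1+s≰n)) (geometric-initial s n (ℕₚ.≰⇒> 1+s≰n))

  ∏< : ℕ → (ℕ → ℤ[[q]]) → ℤ[[q]]
  ∏< zero    F = 𝟏
  ∏< (suc m) F = ∏< m F ⊠ F m

  ∏<-+ : ∀ m r (F : ℕ → ℤ[[q]]) → ∏< (m ℕ.+ r) F ≋ ∏< m F ⊠ ∏< r (λ t → F (m ℕ.+ t))
  ∏<-+ m zero    F rewrite ℕₚ.+-identityʳ m = ≋-sym (⊠-identityʳ (∏< m F))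
  ∏<-+ m (suc r) F rewrite ℕₚ.+-suc m r =
    ≋-trans (⊠-congˡ (F (m ℕ.+ r)) (∏<-+ m r F)) (⊠-assoc (∏< m F) (∏< r (λ t → F (m ℕ.+ t))) (F (m ℕ.+ r)))

  ∏<-inverse : ∀ m {F G : ℕ → ℤ[[q]]} → (∀ t → F t ⊠ G t ≋ 𝟏) → ∏< m F ⊠ ∏< m G ≋ 𝟏
  ∏<-inverse zero    FG≋𝟏 = ⊠-identityˡ 𝟏
  ∏<-inverse (suc m) {F} {G} FG≋𝟏 = begin
    (∏< m F ⊠ F m) ⊠ (∏< m G ⊠ G m)  ≈⟨ solve 4 (λ a b c d → (a :* b) :* (c :* d) := (a :* c) :* (b :* d)) ≋-refl
                                                (∏< m F) (F m) (∏< m G) (G m) ⟩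
    (∏< m F ⊠ ∏< m G) ⊠ (F m ⊠ G m)  ≈⟨ ⊠-cong (∏<-inverse m FG≋𝟏) (FG≋𝟏 m) ⟩
    𝟏 ⊠ 𝟏                            ≈⟨ ⊠-identityˡ 𝟏 ⟩
    𝟏                                ∎
    where open ≋-Reasoning

open PowerSeries
module UVCoefficients where

  open ℤ using (+_)

  infix 10 _⟨_,_⟩
  _⟨_,_⟩ : Ser → ℕ → ℕ → ℤ[[q]]
  (F ⟨ i , j ⟩) n = F i j n

  ConcentratedAt : Ser → ℕ → ℕ → Set
  ConcentratedAt F i₀ j₀ = ∀ i j → ¬ (i ≡ i₀ × j ≡ j₀) → F ⟨ i , j ⟩ ≋ 𝟘

  mono-concentrated : ∀ i₀ j₀ s → ConcentratedAt (mono i₀ j₀ s) i₀ j₀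
  mono-concentrated i₀ j₀ s i j ≢ = mk≋ coefficient
    where
    coefficient : ∀ n → mono i₀ j₀ s i j n ≡ + 0
    coefficient n with i₀ ℕ.≟ i | j₀ ℕ.≟ j
    ... | yes refl | yes refl = contradiction (refl , refl) ≢
    ... | yes refl | no _     = refl
    ... | no _     | _        = refl

  mono-coeff : ∀ i₀ j₀ s → mono i₀ j₀ s ⟨ i₀ , j₀ ⟩ ≋ q^ s
  mono-coeff i₀ j₀ s with i₀ ℕ.≟ i₀ | j₀ ℕ.≟ j₀
  ... | yes _ | yes _ = ≋-refl
  ... | no ≢  | _     = contradiction refl ≢
  ... | yes _ | no ≢  = contradiction refl ≢

  ⊗-distribˡ-⊕ : ∀ F G H i j → (F ⊗ (G ⊕ H)) ⟨ i , j ⟩ ≋ (F ⊗ G) ⟨ i , j ⟩ ⊞ (F ⊗ H) ⟨ i , j ⟩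
  ⊗-distribˡ-⊕ F G H i j = mk≋ λ n →
    trans (Σ<-cong (suc i) (λ i₁ →
            trans (Σ<-cong (suc j) (λ j₁ →
                     at (⊠-distribˡ-⊞ (F ⟨ i₁ , j₁ ⟩) (G ⟨ i ∸ i₁ , j ∸ j₁ ⟩) (H ⟨ i ∸ i₁ , j ∸ j₁ ⟩)) n))
                  (Σ<-distrib-+ (suc j) (term G n i₁) (term H n i₁))))
          (Σ<-distrib-+ (suc i) (λ i₁ → Σ≤ j (term G n i₁)) (λ i₁ → Σ≤ j (term H n i₁)))
    where
    term : Ser → ℕ → ℕ → ℕ → ℤ.ℤ
    term X n i₁ j₁ = (F ⟨ i₁ , j₁ ⟩ ⊠ X ⟨ i ∸ i₁ , j ∸ j₁ ⟩) n

  ⊗-congʳ : ∀ F {G G′} → (∀ i j → G ⟨ i , j ⟩ ≋ G′ ⟨ i , j ⟩) →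
            ∀ i j → (F ⊗ G) ⟨ i , j ⟩ ≋ (F ⊗ G′) ⟨ i , j ⟩
  ⊗-congʳ F G≋G′ i j = mk≋ λ n →
    Σ<-cong (suc i) (λ i₁ → Σ<-cong (suc j) (λ j₁ → at (⊠-congʳ (F ⟨ i₁ , j₁ ⟩) (G≋G′ (i ∸ i₁) (j ∸ j₁))) n))

  ⊗-comm : ∀ F G i j → (F ⊗ G) ⟨ i , j ⟩ ≋ (G ⊗ F) ⟨ i , j ⟩
  ⊗-comm F G i j = mk≋ λ n → begin
    Σ≤ i (λ i₁ → Σ≤ j (λ j₁ → (F ⟨ i₁ , j₁ ⟩ ⊠ G ⟨ i ∸ i₁ , j ∸ j₁ ⟩) n))
      ≡⟨ Σ≤-reverse i _ ⟩
    Σ≤ i (λ i₁ → Σ≤ j (λ j₁ → (F ⟨ i ∸ i₁ , j₁ ⟩ ⊠ G ⟨ i ∸ (i ∸ i₁) , j ∸ j₁ ⟩) n))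
      ≡⟨ Σ<-cong (suc i) (λ i₁ → Σ≤-reverse j _) ⟩
    Σ≤ i (λ i₁ → Σ≤ j (λ j₁ → (F ⟨ i ∸ i₁ , j ∸ j₁ ⟩ ⊠ G ⟨ i ∸ (i ∸ i₁) , j ∸ (j ∸ j₁) ⟩) n))
      ≡⟨ Σ<-cong< (suc i) (λ i₁ i₁≤i → Σ<-cong< (suc j) (λ j₁ j₁≤j →
           trans (cong₂ (λ i₂ j₂ → (F ⟨ i ∸ i₁ , j ∸ j₁ ⟩ ⊠ G ⟨ i₂ , j₂ ⟩) n)
                        (ℕₚ.m∸[m∸n]≡n (ℕₚ.≤-pred i₁≤i)) (ℕₚ.m∸[m∸n]≡n (ℕₚ.≤-pred j₁≤j)))
                 (at (⊠-comm (F ⟨ i ∸ i₁ , j ∸ j₁ ⟩) (G ⟨ i₁ , j₁ ⟩)) n))) ⟩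
    Σ≤ i (λ i₁ → Σ≤ j (λ j₁ → (G ⟨ i₁ , j₁ ⟩ ⊠ F ⟨ i ∸ i₁ , j ∸ j₁ ⟩) n)) ∎
    where open ≡-Reasoning

  concentrated-⊗ : ∀ {F i₀ j₀} → ConcentratedAt F i₀ j₀ → ∀ G i j → i₀ ≤ i → j₀ ≤ j →
    (F ⊗ G) ⟨ i , j ⟩ ≋ F ⟨ i₀ , j₀ ⟩ ⊠ G ⟨ i ∸ i₀ , j ∸ j₀ ⟩
  concentrated-⊗ {F} {i₀} {j₀} F-conc G i j i₀≤i j₀≤j = mk≋ λ n →
    Σ≤²-single i j (λ i₁ j₁ → (F ⟨ i₁ , j₁ ⟩ ⊠ G ⟨ i ∸ i₁ , j ∸ j₁ ⟩) n) i₀ j₀ i₀≤i j₀≤j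
      (λ i₁ j₁ _ _ ≢ → at (≋-trans (⊠-congˡ (G ⟨ i ∸ i₁ , j ∸ j₁ ⟩) (F-conc i₁ j₁ ≢))
                                   (⊠-zeroˡ (G ⟨ i ∸ i₁ , j ∸ j₁ ⟩))) n)

  concentrated-⊗-outside : ∀ {F i₀ j₀} → ConcentratedAt F i₀ j₀ → ∀ G i j → i < i₀ ⊎ j < j₀ →
    (F ⊗ G) ⟨ i , j ⟩ ≋ 𝟘
  concentrated-⊗-outside {F} {i₀} {j₀} F-conc G i j outside = mk≋ λ n →
    Σ≤²-zero i j (λ i₁ j₁ → (F ⟨ i₁ , j₁ ⟩ ⊠ G ⟨ i ∸ i₁ , j ∸ j₁ ⟩) n)
      (λ i₁ j₁ i₁≤i j₁≤j → at (≋-trans (⊠-congˡ (G ⟨ i ∸ i₁ , j ∸ j₁ ⟩) (F-conc i₁ j₁ (differs outside i₁≤i j₁≤j)))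
                                       (⊠-zeroˡ (G ⟨ i ∸ i₁ , j ∸ j₁ ⟩))) n)
    where
    differs : ∀ {i₁ j₁} → i < i₀ ⊎ j < j₀ → i₁ ≤ i → j₁ ≤ j → ¬ (i₁ ≡ i₀ × j₁ ≡ j₀)
    differs (inj₁ i<i₀) i₁≤i _ (refl , refl) = ℕₚ.<⇒≱ i<i₀ i₁≤i
    differs (inj₂ j<j₀) _ j₁≤j (refl , refl) = ℕₚ.<⇒≱ j<j₀ j₁≤j

  concentrated-⊗-concentrated : ∀ {F G i₀ j₀ i₁ j₁} → ConcentratedAt F i₀ j₀ → ConcentratedAt G i₁ j₁ →
    ConcentratedAt (F ⊗ G) (i₀ ℕ.+ i₁) (j₀ ℕ.+ j₁)
  concentrated-⊗-concentrated {F} {G} {i₀} {j₀} F-conc G-conc i j ≢ with i₀ ℕ.≤? i | j₀ ℕ.≤? j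
  ... | yes i₀≤i | yes j₀≤j = ≋-trans (concentrated-⊗ F-conc G i j i₀≤i j₀≤j)
    (≋-trans (⊠-congʳ (F ⟨ i₀ , j₀ ⟩) (G-conc (i ∸ i₀) (j ∸ j₀) λ { (refl , refl) →
       ≢ (sym (ℕₚ.m+[n∸m]≡n i₀≤i) , sym (ℕₚ.m+[n∸m]≡n j₀≤j)) })) (⊠-zeroʳ (F ⟨ i₀ , j₀ ⟩)))
  ... | no i₀≰i | _      = concentrated-⊗-outside F-conc G i j (inj₁ (ℕₚ.≰⇒> i₀≰i))
  ... | yes _   | no j₀≰j = concentrated-⊗-outside F-conc G i j (inj₂ (ℕₚ.≰⇒> j₀≰j))

  ΠS-concentrated : ∀ m F → (∀ t → ConcentratedAt (F t) 0 0) → ConcentratedAt (ΠS m F) 0 0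
  ΠS-concentrated zero    F F-conc = mono-concentrated 0 0 0
  ΠS-concentrated (suc m) F F-conc = concentrated-⊗-concentrated (ΠS-concentrated m F F-conc) (F-conc m)

  ΠS-coeff : ∀ m F → (∀ t → ConcentratedAt (F t) 0 0) → ΠS m F ⟨ 0 , 0 ⟩ ≋ ∏< m (λ t → F t ⟨ 0 , 0 ⟩)
  ΠS-coeff zero    F F-conc = ≋-trans (mono-coeff 0 0 0) q^0≋𝟏
  ΠS-coeff (suc m) F F-conc =
    ≋-trans (concentrated-⊗ (ΠS-concentrated m F F-conc) (F m) 0 0 z≤n z≤n) (⊠-congˡ (F m ⟨ 0 , 0 ⟩) (ΠS-coeff m F F-conc))

  ⊗-mono : ∀ F i₀ j₀ s i j → (F ⊗ mono i₀ j₀ s) ⟨ i₀ ℕ.+ i , j₀ ℕ.+ j ⟩ ≋ q^ s ⊠ F ⟨ i , j ⟩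
  ⊗-mono F i₀ j₀ s i j = begin
    (F ⊗ mono i₀ j₀ s) ⟨ i₀ ℕ.+ i , j₀ ℕ.+ j ⟩
      ≈⟨ ⊗-comm F (mono i₀ j₀ s) (i₀ ℕ.+ i) (j₀ ℕ.+ j) ⟩
    (mono i₀ j₀ s ⊗ F) ⟨ i₀ ℕ.+ i , j₀ ℕ.+ j ⟩
      ≈⟨ concentrated-⊗ (mono-concentrated i₀ j₀ s) F (i₀ ℕ.+ i) (j₀ ℕ.+ j) (ℕₚ.m≤m+n i₀ i) (ℕₚ.m≤m+n j₀ j) ⟩
    mono i₀ j₀ s ⟨ i₀ , j₀ ⟩ ⊠ F ⟨ i₀ ℕ.+ i ∸ i₀ , j₀ ℕ.+ j ∸ j₀ ⟩
      ≡⟨ cong₂ (λ i′ j′ → mono i₀ j₀ s ⟨ i₀ , j₀ ⟩ ⊠ F ⟨ i′ , j′ ⟩) (ℕₚ.m+n∸m≡n i₀ i) (ℕₚ.m+n∸m≡n j₀ j) ⟩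
    mono i₀ j₀ s ⟨ i₀ , j₀ ⟩ ⊠ F ⟨ i , j ⟩
      ≈⟨ ⊠-congˡ (F ⟨ i , j ⟩) (mono-coeff i₀ j₀ s) ⟩
    q^ s ⊠ F ⟨ i , j ⟩ ∎
    where open ≋-Reasoning

  ⊗-mono-outside : ∀ F i₀ j₀ s i j → i < i₀ ⊎ j < j₀ → (F ⊗ mono i₀ j₀ s) ⟨ i , j ⟩ ≋ 𝟘
  ⊗-mono-outside F i₀ j₀ s i j outside =
    ≋-trans (⊗-comm F (mono i₀ j₀ s) i j) (concentrated-⊗-outside (mono-concentrated i₀ j₀ s) F i j outside)

  q^-⊠-mono : ∀ s i₀ j₀ t i j → q^ s ⊠ mono i₀ j₀ t ⟨ i , j ⟩ ≋ mono i₀ j₀ (t ℕ.+ s) ⟨ i , j ⟩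
  q^-⊠-mono s i₀ j₀ t i j with i ℕ.≟ i₀ ×-dec j ℕ.≟ j₀
  ... | yes (refl , refl) = begin
    q^ s ⊠ mono i₀ j₀ t ⟨ i₀ , j₀ ⟩  ≈⟨ ⊠-congʳ (q^ s) (mono-coeff i₀ j₀ t) ⟩
    q^ s ⊠ q^ t                      ≈⟨ ⊠-comm (q^ s) (q^ t) ⟩
    q^ t ⊠ q^ s                      ≈⟨ q^-+ t s ⟩
    q^ (t ℕ.+ s)                     ≈⟨ mono-coeff i₀ j₀ (t ℕ.+ s) ⟨
    mono i₀ j₀ (t ℕ.+ s) ⟨ i₀ , j₀ ⟩ ∎
    where open ≋-Reasoning
  ... | no ≢ = ≋-trans (⊠-congʳ (q^ s) (mono-concentrated i₀ j₀ t i j ≢))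
                 (≋-trans (⊠-zeroʳ (q^ s)) (≋-sym (mono-concentrated i₀ j₀ (t ℕ.+ s) i j ≢)))

open UVCoefficients

module QPochhammer (k′ : ℕ) where

  open ℤ using (+_)

  k : ℕ
  k = suc k′

  qPoch : ℕ → ℤ[[q]]
  qPoch m = ∏< m (λ t → 1- q^ (k ℕ.* suc t))

  qPoch⁻¹ : ℕ → ℤ[[q]]
  qPoch⁻¹ m = ∏< m (λ t → geometric (k ℕ.* suc t))

  geometric-inverseₖ : ∀ t → geometric (k ℕ.* suc t) ⊠ 1- q^ (k ℕ.* suc t) ≋ 𝟏
  geometric-inverseₖ t = geometric-inverse (t ℕ.+ k′ ℕ.* suc t)

  qPoch⁻¹-inverse : ∀ m → qPoch⁻¹ m ⊠ qPoch m ≋ 𝟏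
  qPoch⁻¹-inverse m = ∏<-inverse m geometric-inverseₖ

  -- (1 - r) + r (1 - p) = 1 - p r, divided by (1 - p) (1 - r) (1 - p r).
  pascal-fractions : ∀ p r Gp Gr Gpr →
    Gp ⊠ 1- p ≋ 𝟏 → Gr ⊠ 1- r ≋ 𝟏 → Gpr ⊠ 1- (p ⊠ r) ≋ 𝟏 →
    Gp ⊠ Gpr ⊞ r ⊠ Gr ⊠ Gpr ≋ Gp ⊠ Gr
  pascal-fractions p r Gp Gr Gpr Gp-inv Gr-inv Gpr-inv = begin
    Gp ⊠ Gpr ⊞ r ⊠ Gr ⊠ Gpr
      ≈⟨ ⊞-cong (⊠-identityʳ (Gp ⊠ Gpr)) (⊠-identityʳ (r ⊠ Gr ⊠ Gpr)) ⟨
    Gp ⊠ Gpr ⊠ 𝟏 ⊞ r ⊠ Gr ⊠ Gpr ⊠ 𝟏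
      ≈⟨ ⊞-cong (⊠-congʳ (Gp ⊠ Gpr) Gr-inv) (⊠-congʳ (r ⊠ Gr ⊠ Gpr) Gp-inv) ⟨
    Gp ⊠ Gpr ⊠ (Gr ⊠ 1- r) ⊞ r ⊠ Gr ⊠ Gpr ⊠ (Gp ⊠ 1- p)
      ≈⟨ solve 5 (λ p r Gp Gr Gpr →
           Gp :* Gpr :* (Gr :* (con (+ 1) :- r)) :+ r :* Gr :* Gpr :* (Gp :* (con (+ 1) :- p))
           := Gp :* Gr :* (Gpr :* (con (+ 1) :- p :* r))) ≋-refl p r Gp Gr Gpr ⟩
    Gp ⊠ Gr ⊠ (Gpr ⊠ 1- (p ⊠ r))
      ≈⟨ ⊠-congʳ (Gp ⊠ Gr) Gpr-inv ⟩
    Gp ⊠ Gr ⊠ 𝟏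
      ≈⟨ ⊠-identityʳ (Gp ⊠ Gr) ⟩
    Gp ⊠ Gr ∎
    where open ≋-Reasoning

  -- e_j(q^c, q^(c+k), …, q^(c+k(m-1)))
  elemSym : ℕ → ℕ → ℕ → ℤ[[q]]
  elemSym c m       zero    = 𝟏
  elemSym c zero    (suc j) = 𝟘
  elemSym c (suc m) (suc j) = elemSym c m (suc j) ⊞ q^ (c ℕ.+ k ℕ.* m) ⊠ elemSym c m j

  elemSym-vanishes : ∀ c {m j} → m < j → elemSym c m j ≋ 𝟘
  elemSym-vanishes c {zero}  {suc j} _ = ≋-refl
  elemSym-vanishes c {suc m} {suc j} (s≤s m<j) = begin
    elemSym c m (suc j) ⊞ Y ⊠ elemSym c m j
      ≈⟨ ⊞-cong (elemSym-vanishes c (ℕₚ.m<n⇒m<1+n m<j)) (⊠-congʳ Y (elemSym-vanishes c m<j)) ⟩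
    𝟘 ⊞ Y ⊠ 𝟘  ≈⟨ ⊞-identityˡ (Y ⊠ 𝟘) ⟩
    Y ⊠ 𝟘      ≈⟨ ⊠-zeroʳ Y ⟩
    𝟘          ∎
    where
    open ≋-Reasoning
    Y : ℤ[[q]]
    Y = q^ (c ℕ.+ k ℕ.* m)

  progressionSum : ℕ → ℕ → ℕ
  progressionSum c j = j ℕ.* c ℕ.+ (j C 2) ℕ.* k

  progressionSum-suc : ∀ c j → progressionSum c (suc j) ≡ c ℕ.+ k ℕ.* j ℕ.+ progressionSum c j
  progressionSum-suc c j rewrite C2-suc j = arithmetic c j k (j C 2)
    where
    arithmetic : ∀ c j k t → suc j ℕ.* c ℕ.+ (j ℕ.+ t) ℕ.* k ≡ c ℕ.+ k ℕ.* j ℕ.+ (j ℕ.* c ℕ.+ t ℕ.* k)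
    arithmetic = solve-∀

  gaussian : ℕ → ℕ → ℕ → ℤ[[q]]
  gaussian c i j = q^ (progressionSum c j) ⊠ qPoch⁻¹ i ⊠ qPoch⁻¹ j

  gaussian-pascal : ∀ c i j → let m = i ℕ.+ suc j in
    (gaussian c i (suc j) ⊞ q^ (c ℕ.+ k ℕ.* m) ⊠ gaussian c (suc i) j) ⊠ geometric (k ℕ.* suc m)
      ≋ gaussian c (suc i) (suc j)
  gaussian-pascal c i j = begin
    (W ⊠ P⁻¹ᵢ ⊠ (P⁻¹ⱼ ⊠ gⱼ) ⊞ Y ⊠ (X ⊠ (P⁻¹ᵢ ⊠ gᵢ) ⊠ P⁻¹ⱼ)) ⊠ gₘ
      ≈⟨ solve 8 (λ W X Y P⁻¹ᵢ P⁻¹ⱼ gᵢ gⱼ gₘ →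
           (W :* P⁻¹ᵢ :* (P⁻¹ⱼ :* gⱼ) :+ Y :* (X :* (P⁻¹ᵢ :* gᵢ) :* P⁻¹ⱼ)) :* gₘ
           := W :* P⁻¹ᵢ :* P⁻¹ⱼ :* (gⱼ :* gₘ) :+ (Y :* X) :* P⁻¹ᵢ :* P⁻¹ⱼ :* (gᵢ :* gₘ))
           ≋-refl W X Y P⁻¹ᵢ P⁻¹ⱼ gᵢ gⱼ gₘ ⟩
    W ⊠ P⁻¹ᵢ ⊠ P⁻¹ⱼ ⊠ (gⱼ ⊠ gₘ) ⊞ (Y ⊠ X) ⊠ P⁻¹ᵢ ⊠ P⁻¹ⱼ ⊠ (gᵢ ⊠ gₘ)
      ≈⟨ ⊞-congʳ (W ⊠ P⁻¹ᵢ ⊠ P⁻¹ⱼ ⊠ (gⱼ ⊠ gₘ)) (⊠-congˡ (gᵢ ⊠ gₘ) (⊠-congˡ P⁻¹ⱼ (⊠-congˡ P⁻¹ᵢ YX≋Wr))) ⟩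
    W ⊠ P⁻¹ᵢ ⊠ P⁻¹ⱼ ⊠ (gⱼ ⊠ gₘ) ⊞ (W ⊠ r) ⊠ P⁻¹ᵢ ⊠ P⁻¹ⱼ ⊠ (gᵢ ⊠ gₘ)
      ≈⟨ solve 7 (λ W P⁻¹ᵢ P⁻¹ⱼ gᵢ gⱼ gₘ r →
           W :* P⁻¹ᵢ :* P⁻¹ⱼ :* (gⱼ :* gₘ) :+ (W :* r) :* P⁻¹ᵢ :* P⁻¹ⱼ :* (gᵢ :* gₘ)
           := W :* P⁻¹ᵢ :* P⁻¹ⱼ :* (gⱼ :* gₘ :+ r :* gᵢ :* gₘ))
           ≋-refl W P⁻¹ᵢ P⁻¹ⱼ gᵢ gⱼ gₘ r ⟩
    W ⊠ P⁻¹ᵢ ⊠ P⁻¹ⱼ ⊠ (gⱼ ⊠ gₘ ⊞ r ⊠ gᵢ ⊠ gₘ)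
      ≈⟨ ⊠-congʳ (W ⊠ P⁻¹ᵢ ⊠ P⁻¹ⱼ)
           (pascal-fractions p r gⱼ gᵢ gₘ (geometric-inverseₖ j) (geometric-inverseₖ i) gₘ-inverse) ⟩
    W ⊠ P⁻¹ᵢ ⊠ P⁻¹ⱼ ⊠ (gⱼ ⊠ gᵢ)
      ≈⟨ solve 5 (λ W P⁻¹ᵢ P⁻¹ⱼ gᵢ gⱼ →
           W :* P⁻¹ᵢ :* P⁻¹ⱼ :* (gⱼ :* gᵢ) := W :* (P⁻¹ᵢ :* gᵢ) :* (P⁻¹ⱼ :* gⱼ))
           ≋-refl W P⁻¹ᵢ P⁻¹ⱼ gᵢ gⱼ ⟩
    W ⊠ (P⁻¹ᵢ ⊠ gᵢ) ⊠ (P⁻¹ⱼ ⊠ gⱼ) ∎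
    where
    open ≋-Reasoning
    m : ℕ
    m = i ℕ.+ suc j
    W X Y P⁻¹ᵢ P⁻¹ⱼ gᵢ gⱼ gₘ p r : ℤ[[q]]
    W = q^ progressionSum c (suc j)
    X = q^ progressionSum c j
    Y = q^ (c ℕ.+ k ℕ.* m)
    P⁻¹ᵢ = qPoch⁻¹ i
    P⁻¹ⱼ = qPoch⁻¹ j
    gᵢ = geometric (k ℕ.* suc i)
    gⱼ = geometric (k ℕ.* suc j)
    gₘ = geometric (k ℕ.* suc m)
    p = q^ (k ℕ.* suc j)
    r = q^ (k ℕ.* suc i)
    arithmetic : ∀ c i j k P → c ℕ.+ k ℕ.* j ℕ.+ P ℕ.+ k ℕ.* suc i ≡ c ℕ.+ k ℕ.* (i ℕ.+ suc j) ℕ.+ P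
    arithmetic = solve-∀
    YX≋Wr : Y ⊠ X ≋ W ⊠ r
    YX≋Wr = ≋-trans (q^-+ (c ℕ.+ k ℕ.* m) (progressionSum c j))
      (≋-sym (q^-+-≡ (progressionSum c (suc j)) (k ℕ.* suc i)
        (trans (cong (ℕ._+ k ℕ.* suc i) (progressionSum-suc c j)) (arithmetic c i j k (progressionSum c j)))))
    pr-exponent : ∀ i j k → k ℕ.* suc j ℕ.+ k ℕ.* suc i ≡ k ℕ.* suc (i ℕ.+ suc j)
    pr-exponent = solve-∀
    gₘ-inverse : gₘ ⊠ 1- (p ⊠ r) ≋ 𝟏
    gₘ-inverse = ≋-trans (⊠-congʳ gₘ (⊞-congʳ 𝟏 (⊟-cong (q^-+-≡ (k ℕ.* suc j) (k ℕ.* suc i) (pr-exponent i j k)))))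
                         (geometric-inverseₖ m)

  -- The q-binomial theorem e_j(q^c, …, q^(c+k(i+j-1))) = q^(jc + k C(j,2)) [i+j choose j] in base q^k,
  -- with the Gaussian binomial written as (q^k;q^k)_(i+j) / ((q^k;q^k)_i (q^k;q^k)_j).
  elemSym-gaussian : ∀ c i j → elemSym c (i ℕ.+ j) j ⊠ qPoch⁻¹ (i ℕ.+ j) ≋ gaussian c i j
  elemSym-gaussian c i zero rewrite ℕₚ.+-identityʳ i =
    ≋-trans (⊠-congˡ (qPoch⁻¹ i) (≋-sym q^0≋𝟏)) (≋-sym (⊠-identityʳ (q^ 0 ⊠ qPoch⁻¹ i)))
  elemSym-gaussian c zero (suc j) = begin
    (elemSym c j (suc j) ⊞ Y ⊠ elemSym c j j) ⊠ (qPoch⁻¹ j ⊠ gⱼ)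
      ≈⟨ ⊠-congˡ (qPoch⁻¹ j ⊠ gⱼ) (⊞-congˡ (Y ⊠ elemSym c j j) (elemSym-vanishes c (ℕₚ.n<1+n j))) ⟩
    (𝟘 ⊞ Y ⊠ elemSym c j j) ⊠ (qPoch⁻¹ j ⊠ gⱼ)
      ≈⟨ ⊠-congˡ (qPoch⁻¹ j ⊠ gⱼ) (⊞-identityˡ (Y ⊠ elemSym c j j)) ⟩
    Y ⊠ elemSym c j j ⊠ (qPoch⁻¹ j ⊠ gⱼ)
      ≈⟨ solve 4 (λ Y E P⁻¹ⱼ gⱼ → Y :* E :* (P⁻¹ⱼ :* gⱼ) := Y :* (E :* P⁻¹ⱼ) :* gⱼ)
           ≋-refl Y (elemSym c j j) (qPoch⁻¹ j) gⱼ ⟩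
    Y ⊠ (elemSym c j j ⊠ qPoch⁻¹ j) ⊠ gⱼ
      ≈⟨ ⊠-congˡ gⱼ (⊠-congʳ Y (elemSym-gaussian c zero j)) ⟩
    Y ⊠ (X ⊠ 𝟏 ⊠ qPoch⁻¹ j) ⊠ gⱼ
      ≈⟨ solve 4 (λ Y X P⁻¹ⱼ gⱼ → Y :* (X :* con (+ 1) :* P⁻¹ⱼ) :* gⱼ := Y :* X :* con (+ 1) :* (P⁻¹ⱼ :* gⱼ))
           ≋-refl Y X (qPoch⁻¹ j) gⱼ ⟩
    Y ⊠ X ⊠ 𝟏 ⊠ (qPoch⁻¹ j ⊠ gⱼ)
      ≈⟨ ⊠-congˡ (qPoch⁻¹ j ⊠ gⱼ)
           (⊠-congˡ 𝟏 (q^-+-≡ (c ℕ.+ k ℕ.* j) (progressionSum c j) (sym (progressionSum-suc c j)))) ⟩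
    q^ progressionSum c (suc j) ⊠ 𝟏 ⊠ (qPoch⁻¹ j ⊠ gⱼ) ∎
    where
    open ≋-Reasoning
    X Y gⱼ : ℤ[[q]]
    X = q^ progressionSum c j
    Y = q^ (c ℕ.+ k ℕ.* j)
    gⱼ = geometric (k ℕ.* suc j)
  elemSym-gaussian c (suc i) (suc j) = begin
    (elemSym c m (suc j) ⊞ Y ⊠ elemSym c m j) ⊠ (qPoch⁻¹ m ⊠ gₘ)
      ≈⟨ solve 5 (λ E E′ Y P⁻¹ₘ gₘ →
           (E :+ Y :* E′) :* (P⁻¹ₘ :* gₘ) := (E :* P⁻¹ₘ :+ Y :* (E′ :* P⁻¹ₘ)) :* gₘ)
           ≋-refl (elemSym c m (suc j)) (elemSym c m j) Y (qPoch⁻¹ m) gₘ ⟩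
    (elemSym c m (suc j) ⊠ qPoch⁻¹ m ⊞ Y ⊠ (elemSym c m j ⊠ qPoch⁻¹ m)) ⊠ gₘ
      ≈⟨ ⊠-congˡ gₘ (⊞-cong (elemSym-gaussian c i (suc j)) (⊠-congʳ Y shorter)) ⟩
    (gaussian c i (suc j) ⊞ Y ⊠ gaussian c (suc i) j) ⊠ gₘ
      ≈⟨ gaussian-pascal c i j ⟩
    gaussian c (suc i) (suc j) ∎
    where
    open ≋-Reasoning
    m : ℕ
    m = i ℕ.+ suc j
    Y gₘ : ℤ[[q]]
    Y = q^ (c ℕ.+ k ℕ.* m)
    gₘ = geometric (k ℕ.* suc m)
    shorter : elemSym c m j ⊠ qPoch⁻¹ m ≋ gaussian c (suc i) j
    shorter = subst (λ m → elemSym c m j ⊠ qPoch⁻¹ m ≋ gaussian c (suc i) j)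
                    (sym (ℕₚ.+-suc i j)) (elemSym-gaussian c (suc i) j)

  qPochFrom : ℕ → ℕ → ℤ[[q]]
  qPochFrom d i = ∏< i (λ t → 1- q^ (k ℕ.* suc (d ℕ.+ t)))

  qPochFrom-agreeBelow : ∀ d i → AgreeBelow (suc d) (qPochFrom d i) 𝟏
  qPochFrom-agreeBelow d zero    n n≤d = refl
  qPochFrom-agreeBelow d (suc i) n n≤d =
    trans (⊠-1-q^-agreeBelow s (qPochFrom d i) n (ℕₚ.<-≤-trans n≤d 1+d≤s)) (qPochFrom-agreeBelow d i n n≤d)
    where
    s : ℕ
    s = k ℕ.* suc (d ℕ.+ i)
    1+d≤s : suc d ≤ s
    1+d≤s = ℕₚ.≤-trans (s≤s (ℕₚ.m≤m+n d i)) (ℕₚ.m≤m+n (suc (d ℕ.+ i)) (k′ ℕ.* suc (d ℕ.+ i)))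

  elemSym-factor : ∀ c d i → elemSym c (d ℕ.+ i) i ≋ q^ progressionSum c i ⊠ qPoch⁻¹ i ⊠ qPochFrom d i
  elemSym-factor c d i = begin
    E                                              ≈⟨ ⊠-identityʳ E ⟨
    E ⊠ 𝟏                                          ≈⟨ ⊠-congʳ E (qPoch⁻¹-inverse (d ℕ.+ i)) ⟨
    E ⊠ (qPoch⁻¹ (d ℕ.+ i) ⊠ qPoch (d ℕ.+ i))         ≈⟨ ⊠-assoc E (qPoch⁻¹ (d ℕ.+ i)) (qPoch (d ℕ.+ i)) ⟨
    E ⊠ qPoch⁻¹ (d ℕ.+ i) ⊠ qPoch (d ℕ.+ i)
      ≈⟨ ⊠-cong (elemSym-gaussian c d i) (∏<-+ d i (λ t → 1- q^ (k ℕ.* suc t))) ⟩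
    X ⊠ qPoch⁻¹ d ⊠ qPoch⁻¹ i ⊠ (qPoch d ⊠ qPochFrom d i)
      ≈⟨ solve 5 (λ X P⁻¹d P⁻¹ᵢ Pd R → X :* P⁻¹d :* P⁻¹ᵢ :* (Pd :* R) := X :* P⁻¹ᵢ :* R :* (P⁻¹d :* Pd))
           ≋-refl X (qPoch⁻¹ d) (qPoch⁻¹ i) (qPoch d) (qPochFrom d i) ⟩
    X ⊠ qPoch⁻¹ i ⊠ qPochFrom d i ⊠ (qPoch⁻¹ d ⊠ qPoch d)
      ≈⟨ ⊠-congʳ (X ⊠ qPoch⁻¹ i ⊠ qPochFrom d i) (qPoch⁻¹-inverse d) ⟩
    X ⊠ qPoch⁻¹ i ⊠ qPochFrom d i ⊠ 𝟏                   ≈⟨ ⊠-identityʳ (X ⊠ qPoch⁻¹ i ⊠ qPochFrom d i) ⟩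
    X ⊠ qPoch⁻¹ i ⊠ qPochFrom d i                       ∎
    where
    open ≋-Reasoning
    E X : ℤ[[q]]
    E = elemSym c (d ℕ.+ i) i
    X = q^ progressionSum c i

  elemSym-agreeBelow : ∀ c d i A → AgreeBelow (suc d) (A ⊠ elemSym c (d ℕ.+ i) i) (A ⊠ (q^ progressionSum c i ⊠ qPoch⁻¹ i))
  elemSym-agreeBelow c d i A n n≤d = begin
    (A ⊠ elemSym c (d ℕ.+ i) i) n     ≡⟨ at (⊠-congʳ A (elemSym-factor c d i)) n ⟩
    (A ⊠ (B ⊠ qPochFrom d i)) n        ≡⟨ at (⊠-assoc A B (qPochFrom d i)) n ⟨
    (A ⊠ B ⊠ qPochFrom d i) n          ≡⟨ ⊠-agreeBelow (A ⊠ B) (qPochFrom-agreeBelow d i) n n≤d ⟩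
    (A ⊠ B ⊠ 𝟏) n                     ≡⟨ at (⊠-identityʳ (A ⊠ B)) n ⟩
    (A ⊠ B) n                         ∎
    where
    open ≡-Reasoning
    B : ℤ[[q]]
    B = q^ progressionSum c i ⊠ qPoch⁻¹ i

module Coefficients (k′ a b : ℕ) where

  open QPochhammer k′
  open ℤ using (+_)

  exponent : ℕ → ℕ → ℕ
  exponent i j = (i C 2) ℕ.* k ℕ.+ 2 ℕ.* (j C 2) ℕ.* k ℕ.+ i ℕ.* j ℕ.* k ℕ.+ i ℕ.* a ℕ.+ j ℕ.* b

  coeff : ℕ → ℕ → ℤ[[q]]
  coeff i j = q^ exponent i j ⊠ qPoch⁻¹ i ⊠ qPoch⁻¹ j

  -- The size added when a partition with i + j parts is shifted up by k, resp. shifted by k and given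
  -- a new smallest part a, resp. shifted by 2k and given a new smallest part b.
  Δ₀ Δa Δb : ℕ → ℕ → ℕ
  Δ₀ i j = (i ℕ.+ j) ℕ.* k
  Δa i j = a ℕ.+ (i ℕ.+ j) ℕ.* k
  Δb i j = b ℕ.+ (i ℕ.+ j) ℕ.* (k ℕ.+ k)

  aTerm : ℕ → ℕ → ℤ[[q]]
  aTerm zero    j = 𝟘
  aTerm (suc i) j = q^ Δa i j ⊠ coeff i j

  bTerm : ℕ → ℕ → ℤ[[q]]
  bTerm i zero    = 𝟘
  bTerm i (suc j) = q^ Δb i j ⊠ coeff i j

  fixpoint : ∀ K P Z → K ⊠ 1- P ≋ Z → K ≋ P ⊠ K ⊞ Z
  fixpoint K P Z K[1-P]≋Z = begin
    K                      ≈⟨ solve 2 (λ K P → K := P :* K :+ K :* (con (+ 1) :- P)) ≋-refl K P ⟩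
    P ⊠ K ⊞ K ⊠ 1- P       ≈⟨ ⊞-congʳ (P ⊠ K) K[1-P]≋Z ⟩
    P ⊠ K ⊞ Z              ∎
    where open ≋-Reasoning

  exponent-suc-i : ∀ i j → exponent (suc i) j ≡ Δa i j ℕ.+ exponent i j
  exponent-suc-i i j rewrite C2-suc i = arithmetic i j k a b (i C 2) (j C 2)
    where
    arithmetic : ∀ i j k a b x y → (i ℕ.+ x) ℕ.* k ℕ.+ 2 ℕ.* y ℕ.* k ℕ.+ suc i ℕ.* j ℕ.* k ℕ.+ suc i ℕ.* a ℕ.+ j ℕ.* b
                              ≡ a ℕ.+ (i ℕ.+ j) ℕ.* k ℕ.+ (x ℕ.* k ℕ.+ 2 ℕ.* y ℕ.* k ℕ.+ i ℕ.* j ℕ.* k ℕ.+ i ℕ.* a ℕ.+ j ℕ.* b)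
    arithmetic = solve-∀

  exponent-suc-j : ∀ i j → exponent i (suc j) ≡ b ℕ.+ (i ℕ.+ 2 ℕ.* j) ℕ.* k ℕ.+ exponent i j
  exponent-suc-j i j rewrite C2-suc j = arithmetic i j k a b (i C 2) (j C 2)
    where
    arithmetic : ∀ i j k a b x y → x ℕ.* k ℕ.+ 2 ℕ.* (j ℕ.+ y) ℕ.* k ℕ.+ i ℕ.* suc j ℕ.* k ℕ.+ i ℕ.* a ℕ.+ suc j ℕ.* b
                              ≡ b ℕ.+ (i ℕ.+ 2 ℕ.* j) ℕ.* k ℕ.+ (x ℕ.* k ℕ.+ 2 ℕ.* y ℕ.* k ℕ.+ i ℕ.* j ℕ.* k ℕ.+ i ℕ.* a ℕ.+ j ℕ.* b)
    arithmetic = solve-∀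

  cancel-geometric : ∀ t A → A ⊠ geometric (k ℕ.* suc t) ⊠ 1- q^ (k ℕ.* suc t) ≋ A
  cancel-geometric t A =
    ≋-trans (⊠-assoc A (geometric (k ℕ.* suc t)) (1- q^ (k ℕ.* suc t)))
            (≋-trans (⊠-congʳ A (geometric-inverseₖ t)) (⊠-identityʳ A))

  coeff-suc-i : ∀ i j → coeff (suc i) j ≋ q^ (k ℕ.* suc i) ⊠ coeff (suc i) j ⊞ q^ Δa i j ⊠ coeff i j
  coeff-suc-i i j = fixpoint (coeff (suc i) j) (q^ (k ℕ.* suc i)) (q^ Δa i j ⊠ coeff i j) (begin
    q^ exponent (suc i) j ⊠ (qPoch⁻¹ i ⊠ gᵢ) ⊠ qPoch⁻¹ j ⊠ 1- q^ (k ℕ.* suc i)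
      ≈⟨ ⊠-congˡ (1- q^ (k ℕ.* suc i)) (solve 4 (λ X P g Q → X :* (P :* g) :* Q := X :* P :* Q :* g) ≋-refl
           (q^ exponent (suc i) j) (qPoch⁻¹ i) gᵢ (qPoch⁻¹ j)) ⟩
    q^ exponent (suc i) j ⊠ qPoch⁻¹ i ⊠ qPoch⁻¹ j ⊠ gᵢ ⊠ 1- q^ (k ℕ.* suc i)
      ≈⟨ cancel-geometric i (q^ exponent (suc i) j ⊠ qPoch⁻¹ i ⊠ qPoch⁻¹ j) ⟩
    q^ exponent (suc i) j ⊠ qPoch⁻¹ i ⊠ qPoch⁻¹ j
      ≈⟨ q^-split (Δa i j) (exponent i j) (exponent-suc-i i j) (qPoch⁻¹ i) (qPoch⁻¹ j) ⟩
    q^ Δa i j ⊠ coeff i j ∎)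
    where
    open ≋-Reasoning
    gᵢ : ℤ[[q]]
    gᵢ = geometric (k ℕ.* suc i)

  coeff-suc-j : ∀ i j →
    coeff i (suc j) ≋ q^ (k ℕ.* suc j) ⊠ coeff i (suc j) ⊞ q^ (b ℕ.+ (i ℕ.+ 2 ℕ.* j) ℕ.* k) ⊠ coeff i j
  coeff-suc-j i j = fixpoint (coeff i (suc j)) (q^ (k ℕ.* suc j)) (q^ (b ℕ.+ (i ℕ.+ 2 ℕ.* j) ℕ.* k) ⊠ coeff i j) (begin
    q^ exponent i (suc j) ⊠ qPoch⁻¹ i ⊠ (qPoch⁻¹ j ⊠ gⱼ) ⊠ 1- q^ (k ℕ.* suc j)
      ≈⟨ ⊠-congˡ (1- q^ (k ℕ.* suc j)) (solve 4 (λ X P Q g → X :* P :* (Q :* g) := X :* P :* Q :* g) ≋-refl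
           (q^ exponent i (suc j)) (qPoch⁻¹ i) (qPoch⁻¹ j) gⱼ) ⟩
    q^ exponent i (suc j) ⊠ qPoch⁻¹ i ⊠ qPoch⁻¹ j ⊠ gⱼ ⊠ 1- q^ (k ℕ.* suc j)
      ≈⟨ cancel-geometric j (q^ exponent i (suc j) ⊠ qPoch⁻¹ i ⊠ qPoch⁻¹ j) ⟩
    q^ exponent i (suc j) ⊠ qPoch⁻¹ i ⊠ qPoch⁻¹ j
      ≈⟨ q^-split (b ℕ.+ (i ℕ.+ 2 ℕ.* j) ℕ.* k) (exponent i j) (exponent-suc-j i j) (qPoch⁻¹ i) (qPoch⁻¹ j) ⟩
    q^ (b ℕ.+ (i ℕ.+ 2 ℕ.* j) ℕ.* k) ⊠ coeff i j ∎)
    where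
    open ≋-Reasoning
    gⱼ : ℤ[[q]]
    gⱼ = geometric (k ℕ.* suc j)

  coeff-recurrence : ∀ i j → coeff i j ≋ q^ Δ₀ i j ⊠ coeff i j ⊞ aTerm i j ⊞ bTerm i j
  coeff-recurrence zero zero = begin
    coeff 0 0                        ≈⟨ ⊠-identityˡ (coeff 0 0) ⟨
    𝟏 ⊠ coeff 0 0                    ≈⟨ ⊠-congˡ (coeff 0 0) q^0≋𝟏 ⟨
    q^ 0 ⊠ coeff 0 0                 ≈⟨ ⊞-identityʳ (q^ 0 ⊠ coeff 0 0) ⟨
    q^ 0 ⊠ coeff 0 0 ⊞ 𝟘             ≈⟨ ⊞-identityʳ (q^ 0 ⊠ coeff 0 0 ⊞ 𝟘) ⟨
    q^ 0 ⊠ coeff 0 0 ⊞ 𝟘 ⊞ 𝟘         ∎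
    where open ≋-Reasoning
  coeff-recurrence (suc i) zero = begin
    K                                         ≈⟨ coeff-suc-i i 0 ⟩
    q^ (k ℕ.* suc i) ⊠ K ⊞ aTerm (suc i) 0     ≈⟨ ⊞-congˡ (aTerm (suc i) 0) (⊠-congˡ K (q^-cong (Δ₀-eq i k))) ⟩
    q^ Δ₀ (suc i) 0 ⊠ K ⊞ aTerm (suc i) 0      ≈⟨ ⊞-identityʳ (q^ Δ₀ (suc i) 0 ⊠ K ⊞ aTerm (suc i) 0) ⟨
    q^ Δ₀ (suc i) 0 ⊠ K ⊞ aTerm (suc i) 0 ⊞ 𝟘  ∎
    where
    open ≋-Reasoning
    K : ℤ[[q]]
    K = coeff (suc i) 0
    Δ₀-eq : ∀ i k → k ℕ.* suc i ≡ (suc i ℕ.+ 0) ℕ.* k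
    Δ₀-eq = solve-∀
  coeff-recurrence zero (suc j) = begin
    K                                                  ≈⟨ coeff-suc-j 0 j ⟩
    q^ (k ℕ.* suc j) ⊠ K ⊞ q^ (b ℕ.+ 2 ℕ.* j ℕ.* k) ⊠ coeff 0 j
      ≈⟨ ⊞-cong (⊠-congˡ K (q^-cong (Δ₀-eq j k))) (⊠-congˡ (coeff 0 j) (q^-cong (cong (b ℕ.+_) (Δb-eq j k)))) ⟩
    q^ Δ₀ 0 (suc j) ⊠ K ⊞ bTerm 0 (suc j)             ≈⟨ ⊞-congˡ (bTerm 0 (suc j)) (⊞-identityʳ (q^ Δ₀ 0 (suc j) ⊠ K)) ⟨
    q^ Δ₀ 0 (suc j) ⊠ K ⊞ 𝟘 ⊞ bTerm 0 (suc j)         ∎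
    where
    open ≋-Reasoning
    K : ℤ[[q]]
    K = coeff 0 (suc j)
    Δ₀-eq : ∀ j k → k ℕ.* suc j ≡ suc j ℕ.* k
    Δ₀-eq = solve-∀
    Δb-eq : ∀ j k → 2 ℕ.* j ℕ.* k ≡ j ℕ.* (k ℕ.+ k)
    Δb-eq = solve-∀
  coeff-recurrence (suc i) (suc j) = begin
    K                                      ≈⟨ coeff-suc-i i (suc j) ⟩
    Pᵢ ⊠ K ⊞ Za                            ≈⟨ ⊞-congˡ Za (⊠-congʳ Pᵢ (coeff-suc-j (suc i) j)) ⟩
    Pᵢ ⊠ (Pⱼ ⊠ K ⊞ Xd ⊠ Kb) ⊞ Za
      ≈⟨ solve 6 (λ Pᵢ Pⱼ K Xd Kb Za → Pᵢ :* (Pⱼ :* K :+ Xd :* Kb) :+ Za := Pᵢ :* Pⱼ :* K :+ Za :+ Pᵢ :* Xd :* Kb)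
           ≋-refl Pᵢ Pⱼ K Xd Kb Za ⟩
    Pᵢ ⊠ Pⱼ ⊠ K ⊞ Za ⊞ Pᵢ ⊠ Xd ⊠ Kb
      ≈⟨ ⊞-cong (⊞-congˡ Za (⊠-congˡ K (q^-+-≡ (k ℕ.* suc i) (k ℕ.* suc j) (Δ₀-eq i j k))))
                (⊠-congˡ Kb (q^-+-≡ (k ℕ.* suc i) (b ℕ.+ (suc i ℕ.+ 2 ℕ.* j) ℕ.* k) (Δb-eq i j k b))) ⟩
    q^ Δ₀ (suc i) (suc j) ⊠ K ⊞ Za ⊞ q^ Δb (suc i) j ⊠ Kb ∎
    where
    open ≋-Reasoning
    K Kb Pᵢ Pⱼ Xd Za : ℤ[[q]]
    K  = coeff (suc i) (suc j)
    Kb = coeff (suc i) j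
    Pᵢ = q^ (k ℕ.* suc i)
    Pⱼ = q^ (k ℕ.* suc j)
    Xd = q^ (b ℕ.+ (suc i ℕ.+ 2 ℕ.* j) ℕ.* k)
    Za = q^ Δa i (suc j) ⊠ coeff i (suc j)
    Δ₀-eq : ∀ i j k → k ℕ.* suc i ℕ.+ k ℕ.* suc j ≡ (suc i ℕ.+ suc j) ℕ.* k
    Δ₀-eq = solve-∀
    Δb-eq : ∀ i j k b → k ℕ.* suc i ℕ.+ (b ℕ.+ (suc i ℕ.+ 2 ℕ.* j) ℕ.* k) ≡ b ℕ.+ (suc i ℕ.+ j) ℕ.* (k ℕ.+ k)
    Δb-eq = solve-∀

module SeriesSides (k′ a b : ℕ) where

  open QPochhammer k′
  open Coefficients k′ a b
  open ℤ using (+_; _+_)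

  ΣS-coeff : ∀ M F i j n → ΣS M F i j n ≡ Σ< M (λ m → F m i j n)
  ΣS-coeff zero    F i j n = refl
  ΣS-coeff (suc M) F i j n = cong (_+ F M i j n) (ΣS-coeff M F i j n)

  geomInv-concentrated : ∀ s → ConcentratedAt (geomInv s) 0 0
  geomInv-concentrated s zero    zero    ≢ = contradiction (refl , refl) ≢
  geomInv-concentrated s zero    (suc j) ≢ = ≋-refl
  geomInv-concentrated s (suc i) j       ≢ = ≋-refl

  invQPoch-concentrated : ∀ m → ConcentratedAt (invQPoch k m) 0 0
  invQPoch-concentrated m = ΠS-concentrated m (λ t → geomInv (k ℕ.* suc t)) (λ t → geomInv-concentrated (k ℕ.* suc t))

  invQPoch-coeff : ∀ m → invQPoch k m ⟨ 0 , 0 ⟩ ≋ qPoch⁻¹ m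
  invQPoch-coeff m = ΠS-coeff m (λ t → geomInv (k ℕ.* suc t)) (λ t → geomInv-concentrated (k ℕ.* suc t))

  prefactor : ℕ → ℕ → ℕ → Ser
  prefactor h e m = mono 0 h e ⊗ invQPoch k m

  prefactor-concentrated : ∀ h e m → ConcentratedAt (prefactor h e m) 0 h
  prefactor-concentrated h e m = subst (ConcentratedAt (prefactor h e m) 0) (ℕₚ.+-identityʳ h)
    (concentrated-⊗-concentrated (mono-concentrated 0 h e) (invQPoch-concentrated m))

  prefactor-coeff : ∀ h e m → prefactor h e m ⟨ 0 , h ⟩ ≋ q^ e ⊠ qPoch⁻¹ m
  prefactor-coeff h e m = begin
    prefactor h e m ⟨ 0 , h ⟩
      ≈⟨ concentrated-⊗ (mono-concentrated 0 h e) (invQPoch k m) 0 h z≤n ℕₚ.≤-refl ⟩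
    mono 0 h e ⟨ 0 , h ⟩ ⊠ invQPoch k m ⟨ 0 , h ∸ h ⟩
      ≡⟨ cong (λ j → mono 0 h e ⟨ 0 , h ⟩ ⊠ invQPoch k m ⟨ 0 , j ⟩) (ℕₚ.n∸n≡0 h) ⟩
    mono 0 h e ⟨ 0 , h ⟩ ⊠ invQPoch k m ⟨ 0 , 0 ⟩
      ≈⟨ ⊠-cong (mono-coeff 0 h e) (invQPoch-coeff m) ⟩
    q^ e ⊠ qPoch⁻¹ m ∎
    where open ≋-Reasoning

  midExponent rightExponent : ℕ → ℕ
  midExponent m   = k ℕ.* (m C 2) ℕ.+ m ℕ.* a
  rightExponent h = 2 ℕ.* k ℕ.* (h C 2) ℕ.+ b ℕ.* h

  uvProduct : ℕ → Ser
  uvProduct m = ΠS m (λ t → mono 1 0 0 ⊕ mono 0 1 (b ∸ a ℕ.+ k ℕ.* t))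

  uvProduct-suc : ∀ m i j → uvProduct (suc m) ⟨ i , j ⟩
    ≋ (uvProduct m ⊗ mono 1 0 0) ⟨ i , j ⟩ ⊞ (uvProduct m ⊗ mono 0 1 (b ∸ a ℕ.+ k ℕ.* m)) ⟨ i , j ⟩
  uvProduct-suc m = ⊗-distribˡ-⊕ (uvProduct m) (mono 1 0 0) (mono 0 1 (b ∸ a ℕ.+ k ℕ.* m))

  uvProduct-off : ∀ m i j → ¬ i ℕ.+ j ≡ m → uvProduct m ⟨ i , j ⟩ ≋ 𝟘
  uvProduct-off zero    i j ≢ = mono-concentrated 0 0 0 i j λ { (refl , refl) → ≢ refl }
  uvProduct-off (suc m) i j ≢ =
    ≋-trans (uvProduct-suc m i j) (≋-trans (⊞-cong (u-part i ≢) (v-part j ≢)) (⊞-identityˡ 𝟘))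
    where
    y : ℕ
    y = b ∸ a ℕ.+ k ℕ.* m
    u-part : ∀ i → ¬ i ℕ.+ j ≡ suc m → (uvProduct m ⊗ mono 1 0 0) ⟨ i , j ⟩ ≋ 𝟘
    u-part zero    _ = ⊗-mono-outside (uvProduct m) 1 0 0 0 j (inj₁ (s≤s z≤n))
    u-part (suc i) ≢ = ≋-trans (⊗-mono (uvProduct m) 1 0 0 i j)
      (≋-trans (⊠-congʳ (q^ 0) (uvProduct-off m i j (≢ ∘ cong suc))) (⊠-zeroʳ (q^ 0)))
    v-part : ∀ j → ¬ i ℕ.+ j ≡ suc m → (uvProduct m ⊗ mono 0 1 y) ⟨ i , j ⟩ ≋ 𝟘
    v-part zero    _ = ⊗-mono-outside (uvProduct m) 0 1 y i 0 (inj₂ (s≤s z≤n))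
    v-part (suc j) ≢ = ≋-trans (⊗-mono (uvProduct m) 0 1 y i j)
      (≋-trans (⊠-congʳ (q^ y) (uvProduct-off m i j (≢ ∘ trans (ℕₚ.+-suc i j) ∘ cong suc))) (⊠-zeroʳ (q^ y)))

  uvProduct-on : ∀ m i j → i ℕ.+ j ≡ m → uvProduct m ⟨ i , j ⟩ ≋ elemSym (b ∸ a) m j
  uvProduct-on zero    zero zero refl = ≋-trans (mono-coeff 0 0 0) q^0≋𝟏
  uvProduct-on (suc m) i    j    i+j≡1+m = begin
    uvProduct (suc m) ⟨ i , j ⟩                                ≈⟨ uvProduct-suc m i j ⟩
    (M ⊗ mono 1 0 0) ⟨ i , j ⟩ ⊞ (M ⊗ mono 0 1 y) ⟨ i , j ⟩   ≈⟨ ⊞-congˡ ((M ⊗ mono 0 1 y) ⟨ i , j ⟩) (u-part i i+j≡1+m) ⟩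
    elemSym (b ∸ a) m j ⊞ (M ⊗ mono 0 1 y) ⟨ i , j ⟩          ≈⟨ v-part j i+j≡1+m ⟩
    elemSym (b ∸ a) (suc m) j                                  ∎
    where
    open ≋-Reasoning
    M : Ser
    M = uvProduct m
    y : ℕ
    y = b ∸ a ℕ.+ k ℕ.* m
    u-part : ∀ i → i ℕ.+ j ≡ suc m → (M ⊗ mono 1 0 0) ⟨ i , j ⟩ ≋ elemSym (b ∸ a) m j
    u-part zero    refl = ≋-trans (⊗-mono-outside M 1 0 0 0 j (inj₁ (s≤s z≤n)))
                                  (≋-sym (elemSym-vanishes (b ∸ a) (ℕₚ.n<1+n m)))
    u-part (suc i) 1+i+j≡1+m = ≋-trans (⊗-mono M 1 0 0 i j)
      (≋-trans (⊠-congʳ (q^ 0) (uvProduct-on m i j (ℕₚ.suc-injective 1+i+j≡1+m)))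
               (q^0-identityˡ (elemSym (b ∸ a) m j)))
    v-part : ∀ j → i ℕ.+ j ≡ suc m → elemSym (b ∸ a) m j ⊞ (M ⊗ mono 0 1 y) ⟨ i , j ⟩ ≋ elemSym (b ∸ a) (suc m) j
    v-part zero    _ = ≋-trans (⊞-congʳ 𝟏 (⊗-mono-outside M 0 1 y i 0 (inj₂ (s≤s z≤n)))) (⊞-identityʳ 𝟏)
    v-part (suc j) i+1+j≡1+m = ⊞-congʳ (elemSym (b ∸ a) m (suc j)) (≋-trans (⊗-mono M 0 1 y i j)
      (⊠-congʳ (q^ y) (uvProduct-on m i j (ℕₚ.suc-injective (trans (sym (ℕₚ.+-suc i j)) i+1+j≡1+m)))))

  midTerm-coeff : ∀ m i j → midTerm a b k m ⟨ i , j ⟩ ≋ q^ midExponent m ⊠ qPoch⁻¹ m ⊠ uvProduct m ⟨ i , j ⟩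
  midTerm-coeff m i j =
    ≋-trans (concentrated-⊗ (prefactor-concentrated 0 (midExponent m) m) (uvProduct m) i j z≤n z≤n)
            (⊠-congˡ (uvProduct m ⟨ i , j ⟩) (prefactor-coeff 0 (midExponent m) m))

  midTerm-off : ∀ m i j → ¬ i ℕ.+ j ≡ m → midTerm a b k m ⟨ i , j ⟩ ≋ 𝟘
  midTerm-off m i j ≢ = ≋-trans (midTerm-coeff m i j)
    (≋-trans (⊠-congʳ (q^ midExponent m ⊠ qPoch⁻¹ m) (uvProduct-off m i j ≢)) (⊠-zeroʳ (q^ midExponent m ⊠ qPoch⁻¹ m)))

  exponent-mid : a ≤ b → ∀ i j → exponent i j ≡ midExponent (i ℕ.+ j) ℕ.+ progressionSum (b ∸ a) j
  exponent-mid a≤b i j rewrite C2-+ i j | sym (ℕₚ.m∸n+n≡m a≤b) | ℕₚ.m+n∸n≡m (b ∸ a) a =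
    arithmetic i j k a (b ∸ a) (i C 2) (j C 2)
    where
    arithmetic : ∀ i j k a d x y → x ℕ.* k ℕ.+ 2 ℕ.* y ℕ.* k ℕ.+ i ℕ.* j ℕ.* k ℕ.+ i ℕ.* a ℕ.+ j ℕ.* (d ℕ.+ a)
                                   ≡ k ℕ.* (x ℕ.+ y ℕ.+ i ℕ.* j) ℕ.+ (i ℕ.+ j) ℕ.* a ℕ.+ (j ℕ.* d ℕ.+ y ℕ.* k)
    arithmetic = solve-∀

  midTerm-on : a ≤ b → ∀ i j → midTerm a b k (i ℕ.+ j) ⟨ i , j ⟩ ≋ coeff i j
  midTerm-on a≤b i j = begin
    midTerm a b k m ⟨ i , j ⟩                  ≈⟨ midTerm-coeff m i j ⟩
    q^ e ⊠ qPoch⁻¹ m ⊠ uvProduct m ⟨ i , j ⟩   ≈⟨ ⊠-congʳ (q^ e ⊠ qPoch⁻¹ m) (uvProduct-on m i j refl) ⟩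
    q^ e ⊠ qPoch⁻¹ m ⊠ elemSym (b ∸ a) m j     ≈⟨ solve 3 (λ X P E → X :* P :* E := X :* (E :* P)) ≋-refl
                                                           (q^ e) (qPoch⁻¹ m) (elemSym (b ∸ a) m j) ⟩
    q^ e ⊠ (elemSym (b ∸ a) m j ⊠ qPoch⁻¹ m)   ≈⟨ ⊠-congʳ (q^ e) (elemSym-gaussian (b ∸ a) i j) ⟩
    q^ e ⊠ gaussian (b ∸ a) i j                ≈⟨ q^-split e (progressionSum (b ∸ a) j) (exponent-mid a≤b i j)
                                                           (qPoch⁻¹ i) (qPoch⁻¹ j) ⟨
    coeff i j                                  ∎
    where
    open ≋-Reasoning
    m e : ℕ
    m = i ℕ.+ j
    e = midExponent m

  midPartial-coeff : a ≤ b → ∀ i j n M → i ℕ.+ j < M → midPartial a b k M i j n ≡ coeff i j n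
  midPartial-coeff a≤b i j n M i+j<M = begin
    midPartial a b k M i j n               ≡⟨ ΣS-coeff M (midTerm a b k) i j n ⟩
    Σ< M (λ m → midTerm a b k m i j n)     ≡⟨ Σ<-single M (λ m → midTerm a b k m i j n) (i ℕ.+ j) i+j<M
                                                 (λ m _ m≢i+j → at (midTerm-off m i j (m≢i+j ∘ sym)) n) ⟩
    midTerm a b k (i ℕ.+ j) i j n          ≡⟨ at (midTerm-on a≤b i j) n ⟩
    coeff i j n                            ∎
    where open ≡-Reasoning

  uProduct : ℕ → ℕ → Ser
  uProduct h M = poch (⊝ mono 1 0 (k ℕ.* h ℕ.+ a)) k M

  uProduct-factor : ∀ c s i j → (𝟙 ⊕ ⊝ (⊝ mono 1 0 c ⊗ mono 0 0 s)) ⟨ i , j ⟩ ≋ (𝟙 ⊕ mono 1 0 (c ℕ.+ s)) ⟨ i , j ⟩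
  uProduct-factor c s i j = ⊞-congʳ (𝟙 ⟨ i , j ⟩) (begin
    ⊟ (⊝ mono 1 0 c ⊗ mono 0 0 s) ⟨ i , j ⟩  ≈⟨ ⊟-cong (⊗-mono (⊝ mono 1 0 c) 0 0 s i j) ⟩
    ⊟ (q^ s ⊠ ⊟ mono 1 0 c ⟨ i , j ⟩)        ≈⟨ solve 2 (λ x y → :- (x :* :- y) := x :* y) ≋-refl (q^ s) (mono 1 0 c ⟨ i , j ⟩) ⟩
    q^ s ⊠ mono 1 0 c ⟨ i , j ⟩              ≈⟨ q^-⊠-mono s 1 0 c i j ⟩
    mono 1 0 (c ℕ.+ s) ⟨ i , j ⟩             ∎)
    where open ≋-Reasoning

  uProduct-suc : ∀ h M i j → uProduct h (suc M) ⟨ i , j ⟩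
    ≋ uProduct h M ⟨ i , j ⟩ ⊞ (uProduct h M ⊗ mono 1 0 (k ℕ.* h ℕ.+ a ℕ.+ k ℕ.* M)) ⟨ i , j ⟩
  uProduct-suc h M i j = begin
    uProduct h (suc M) ⟨ i , j ⟩                      ≈⟨ ⊗-congʳ U (uProduct-factor (k ℕ.* h ℕ.+ a) (k ℕ.* M)) i j ⟩
    (U ⊗ (𝟙 ⊕ mono 1 0 y)) ⟨ i , j ⟩                  ≈⟨ ⊗-distribˡ-⊕ U 𝟙 (mono 1 0 y) i j ⟩
    (U ⊗ 𝟙) ⟨ i , j ⟩ ⊞ (U ⊗ mono 1 0 y) ⟨ i , j ⟩    ≈⟨ ⊞-congˡ ((U ⊗ mono 1 0 y) ⟨ i , j ⟩)
                                                             (≋-trans (⊗-mono U 0 0 0 i j) (q^0-identityˡ (U ⟨ i , j ⟩))) ⟩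
    U ⟨ i , j ⟩ ⊞ (U ⊗ mono 1 0 y) ⟨ i , j ⟩          ∎
    where
    open ≋-Reasoning
    U : Ser
    U = uProduct h M
    y : ℕ
    y = k ℕ.* h ℕ.+ a ℕ.+ k ℕ.* M

  uProduct-v : ∀ h M i j → uProduct h M ⟨ i , suc j ⟩ ≋ 𝟘
  uProduct-v h zero    i j = mono-concentrated 0 0 0 i (suc j) (λ ())
  uProduct-v h (suc M) i j =
    ≋-trans (uProduct-suc h M i (suc j)) (≋-trans (⊞-cong (uProduct-v h M i j) (u-part i)) (⊞-identityˡ 𝟘))
    where
    y : ℕ
    y = k ℕ.* h ℕ.+ a ℕ.+ k ℕ.* M
    u-part : ∀ i → (uProduct h M ⊗ mono 1 0 y) ⟨ i , suc j ⟩ ≋ 𝟘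
    u-part zero    = ⊗-mono-outside (uProduct h M) 1 0 y 0 (suc j) (inj₁ (s≤s z≤n))
    u-part (suc i) = ≋-trans (⊗-mono (uProduct h M) 1 0 y i (suc j))
                             (≋-trans (⊠-congʳ (q^ y) (uProduct-v h M i j)) (⊠-zeroʳ (q^ y)))

  uProduct-u : ∀ h M i → uProduct h M ⟨ i , 0 ⟩ ≋ elemSym (k ℕ.* h ℕ.+ a) M i
  uProduct-u h zero    zero    = ≋-trans (mono-coeff 0 0 0) q^0≋𝟏
  uProduct-u h zero    (suc i) = mono-concentrated 0 0 0 (suc i) 0 (λ ())
  uProduct-u h (suc M) zero    = ≋-trans (uProduct-suc h M 0 0)
    (≋-trans (⊞-cong (uProduct-u h M 0) (⊗-mono-outside (uProduct h M) 1 0 y 0 0 (inj₁ (s≤s z≤n)))) (⊞-identityʳ 𝟏))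
    where
    y : ℕ
    y = k ℕ.* h ℕ.+ a ℕ.+ k ℕ.* M
  uProduct-u h (suc M) (suc i) = ≋-trans (uProduct-suc h M (suc i) 0)
    (⊞-cong (uProduct-u h M (suc i)) (≋-trans (⊗-mono (uProduct h M) 1 0 y i 0) (⊠-congʳ (q^ y) (uProduct-u h M i))))
    where
    y : ℕ
    y = k ℕ.* h ℕ.+ a ℕ.+ k ℕ.* M

  rightTerm-on : ∀ M i j → rightTerm a b k M j ⟨ i , j ⟩ ≋ q^ rightExponent j ⊠ qPoch⁻¹ j ⊠ elemSym (k ℕ.* j ℕ.+ a) M i
  rightTerm-on M i j = begin
    rightTerm a b k M j ⟨ i , j ⟩
      ≈⟨ concentrated-⊗ (prefactor-concentrated j (rightExponent j) j) (uProduct j M) i j z≤n ℕₚ.≤-refl ⟩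
    prefactor j (rightExponent j) j ⟨ 0 , j ⟩ ⊠ uProduct j M ⟨ i , j ∸ j ⟩
      ≡⟨ cong (λ j′ → prefactor j (rightExponent j) j ⟨ 0 , j ⟩ ⊠ uProduct j M ⟨ i , j′ ⟩) (ℕₚ.n∸n≡0 j) ⟩
    prefactor j (rightExponent j) j ⟨ 0 , j ⟩ ⊠ uProduct j M ⟨ i , 0 ⟩
      ≈⟨ ⊠-cong (prefactor-coeff j (rightExponent j) j) (uProduct-u j M i) ⟩
    q^ rightExponent j ⊠ qPoch⁻¹ j ⊠ elemSym (k ℕ.* j ℕ.+ a) M i ∎
    where open ≋-Reasoning

  rightTerm-off : ∀ M h i j → ¬ j ≡ h → rightTerm a b k M h ⟨ i , j ⟩ ≋ 𝟘
  rightTerm-off M h i j j≢h = by-cases (h ℕ.≤? j)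
    where
    A : ℤ[[q]]
    A = prefactor h (rightExponent h) h ⟨ 0 , h ⟩
    vanishes : ∀ d → j ∸ h ≡ d → h ≤ j → A ⊠ uProduct h M ⟨ i , j ∸ h ⟩ ≋ 𝟘
    vanishes zero    j∸h≡0   h≤j = contradiction (ℕₚ.≤-antisym (ℕₚ.m∸n≡0⇒m≤n j∸h≡0) h≤j) j≢h
    vanishes (suc d) j∸h≡1+d _   rewrite j∸h≡1+d = ≋-trans (⊠-congʳ A (uProduct-v h M i d)) (⊠-zeroʳ A)
    by-cases : Dec (h ≤ j) → rightTerm a b k M h ⟨ i , j ⟩ ≋ 𝟘
    by-cases (yes h≤j) = ≋-trans (concentrated-⊗ (prefactor-concentrated h (rightExponent h) h) (uProduct h M) i j z≤n h≤j)
                                 (vanishes (j ∸ h) refl h≤j)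
    by-cases (no h≰j)  = concentrated-⊗-outside (prefactor-concentrated h (rightExponent h) h) (uProduct h M) i j
                                                (inj₂ (ℕₚ.≰⇒> h≰j))

  exponent-right : ∀ i j → rightExponent j ℕ.+ progressionSum (k ℕ.* j ℕ.+ a) i ≡ exponent i j
  exponent-right i j = arithmetic i j k a b (i C 2) (j C 2)
    where
    arithmetic : ∀ i j k a b x y → 2 ℕ.* k ℕ.* y ℕ.+ b ℕ.* j ℕ.+ (i ℕ.* (k ℕ.* j ℕ.+ a) ℕ.+ x ℕ.* k)
                                   ≡ x ℕ.* k ℕ.+ 2 ℕ.* y ℕ.* k ℕ.+ i ℕ.* j ℕ.* k ℕ.+ i ℕ.* a ℕ.+ j ℕ.* b
    arithmetic = solve-∀

  rightPartial-coeff : ∀ i j n M → n ℕ.+ i ℕ.+ j < M → rightPartial a b k M i j n ≡ coeff i j n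
  rightPartial-coeff i j n M n+i+j<M = begin
    rightPartial a b k M i j n                   ≡⟨ ΣS-coeff M (rightTerm a b k M) i j n ⟩
    Σ< M (λ h → rightTerm a b k M h i j n)       ≡⟨ Σ<-single M (λ h → rightTerm a b k M h i j n) j j<M
                                                       (λ h _ h≢j → at (rightTerm-off M h i j (h≢j ∘ sym)) n) ⟩
    rightTerm a b k M j i j n                    ≡⟨ at (rightTerm-on M i j) n ⟩
    (A ⊠ elemSym c M i) n                        ≡⟨ cong (λ M → (A ⊠ elemSym c M i) n) (sym (ℕₚ.m∸n+n≡m i≤M)) ⟩
    (A ⊠ elemSym c (M ∸ i ℕ.+ i) i) n            ≡⟨ elemSym-agreeBelow c (M ∸ i) i A n (s≤s n≤M∸i) ⟩
    (A ⊠ (q^ progressionSum c i ⊠ qPoch⁻¹ i)) n  ≡⟨ at collect n ⟩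
    coeff i j n                                  ∎
    where
    open ≡-Reasoning
    c : ℕ
    c = k ℕ.* j ℕ.+ a
    A : ℤ[[q]]
    A = q^ rightExponent j ⊠ qPoch⁻¹ j
    j<M : j < M
    j<M = ℕₚ.≤-<-trans (ℕₚ.m≤n+m j (n ℕ.+ i)) n+i+j<M
    n+i≤M : n ℕ.+ i ≤ M
    n+i≤M = ℕₚ.<⇒≤ (ℕₚ.≤-<-trans (ℕₚ.m≤m+n (n ℕ.+ i) j) n+i+j<M)
    i≤M : i ≤ M
    i≤M = ℕₚ.≤-trans (ℕₚ.m≤n+m i n) n+i≤M
    n≤M∸i : n ≤ M ∸ i
    n≤M∸i = ℕₚ.≤-trans (ℕₚ.≤-reflexive (sym (ℕₚ.m+n∸n≡m n i))) (ℕₚ.∸-monoˡ-≤ i n+i≤M)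
    collect : A ⊠ (q^ progressionSum c i ⊠ qPoch⁻¹ i) ≋ coeff i j
    collect = ≋-trans (solve 4 (λ X P Y Q → X :* P :* (Y :* Q) := X :* Y :* Q :* P) ≋-refl
                                (q^ rightExponent j) (qPoch⁻¹ j) (q^ progressionSum c i) (qPoch⁻¹ i))
      (⊠-congˡ (qPoch⁻¹ j) (⊠-congˡ (qPoch⁻¹ i) (q^-+-≡ (rightExponent j) (progressionSum c i) (exponent-right i j))))
×-irrelevant : ∀ {A B : Set} → Irrelevant A → Irrelevant B → Irrelevant (A × B)
×-irrelevant A-irr B-irr (x , y) (x′ , y′) = cong₂ _,_ (A-irr x x′) (B-irr y y′)

Σ↔Σ-injective-onto : ∀ {A B : Set} {P : A → Set} {Q : B → Set} →
  (∀ {x} → Irrelevant (P x)) → (∀ {y} → Irrelevant (Q y)) →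
  (g : B → A) → (∀ {y} → Q y → P (g y)) → (∀ {y y′} → Q y → Q y′ → g y ≡ g y′ → y ≡ y′) →
  (∀ {x} → P x → Σ B λ y → Q y × g y ≡ x) → Σ B Q ↔ Σ A P
Σ↔Σ-injective-onto {A} {B} {P} {Q} P-irr Q-irr g g-P g-injective g-onto = mk↔ₛ′ to from to∘from from∘to
  where
  to : Σ B Q → Σ A P
  to (y , q) = g y , g-P q
  from : Σ A P → Σ B Q
  from (x , p) = let (y , q , _) = g-onto p in y , q
  to∘from : ∀ z → to (from z) ≡ z
  to∘from (x , p) with g-onto p
  ... | y , q , refl = cong (g y ,_) (P-irr (g-P q) p)
  from∘to : ∀ w → from (to w) ≡ w
  from∘to (y , q) with g-onto (g-P q)
  ... | y′ , q′ , e with g-injective q′ q e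
  ...   | refl = cong (y ,_) (Q-irr q′ q)

Σ-↔-×-inhabited : ∀ {A X : Set} {P : X → Set} → Irrelevant A → A → Σ X P ↔ Σ X (λ x → A × P x)
Σ-↔-×-inhabited A-irr a = mk↔ₛ′ (λ (x , p) → x , a , p) (λ (x , _ , p) → x , p)
  (λ (x , a′ , p) → cong (λ a → x , a , p) (A-irr a a′)) (λ _ → refl)

Σ-distribʳ-⊎³ : ∀ {X Y Z : Set} (P : (X ⊎ Y) ⊎ Z → Set) →
  Σ ((X ⊎ Y) ⊎ Z) P ↔ ((Σ X (P ∘ inj₁ ∘ inj₁) ⊎ Σ Y (P ∘ inj₁ ∘ inj₂)) ⊎ Σ Z (P ∘ inj₂))
Σ-distribʳ-⊎³ P = (Σ-distribʳ-⊎ ⊎-↔ ↔-id _) ↔-∘ Σ-distribʳ-⊎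

Counts : ℤ.ℤ → Set → Set
Counts z X = Σ ℕ λ c → z ≡ ℤ.+ c × (Fin c ↔ X)

counts-≡ : ∀ {z z′ X} → z ≡ z′ → Counts z X → Counts z′ X
counts-≡ refl counted = counted

counts-↔ : ∀ {z X Y} → X ↔ Y → Counts z X → Counts z Y
counts-↔ X↔Y (c , z≡c , Fin↔X) = c , z≡c , X↔Y ↔-∘ Fin↔X

counts-empty : ∀ {X} → ¬ X → Counts (ℤ.+ 0) X
counts-empty ¬X = 0 , refl , mk↔ₛ′ (λ ()) (λ x → contradiction x ¬X) (λ x → contradiction x ¬X) (λ ())

counts-unique : ∀ {X} (x : X) → (∀ y → x ≡ y) → Counts (ℤ.+ 1) X
counts-unique x unique = 1 , refl , mk↔ₛ′ (λ _ → x) (λ _ → Fin.zero) unique (λ { Fin.zero → refl ; (Fin.suc ()) })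

counts-⊎ : ∀ {z w X Y} → Counts z X → Counts w Y → Counts (z ℤ.+ w) (X ⊎ Y)
counts-⊎ (c , refl , Fin↔X) (d , refl , Fin↔Y) =
  c ℕ.+ d , sym (ℤₚ.pos-+ c d) , (Fin↔X ⊎-↔ Fin↔Y) ↔-∘ Finₚ.+↔⊎ {c} {d}

module Partitions (k′ a b : ℕ) (1≤a : 1 ≤ a) (a<b : a < b) (b≤k : b ≤ suc k′) where

  open import Data.Nat using (_+_; _*_)

  open Coefficients k′ a b using (coeff; Δ₀; Δa; Δb; aTerm; bTerm; coeff-recurrence)

  k : ℕ
  k = suc k′

  D : List ℕ → Set
  D = InD a b k

  δ : ℕ → ℕ
  δ p = if ⌊ p % k ℕ.≟ b % k ⌋ then 1 else 0

  congruent-<⇒+k≤ : ∀ {p x} → p % k ≡ x % k → x < p → x + k ≤ p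
  congruent-<⇒+k≤ {p} {x} p≡x x<p = begin
    x + k                   ≡⟨ cong (_+ k) (m≡m%n+[m/n]*n x k) ⟩
    x % k + x / k * k + k   ≡⟨ ℕₚ.+-assoc (x % k) (x / k * k) k ⟩
    x % k + (x / k * k + k) ≡⟨ cong (x % k +_) (ℕₚ.+-comm (x / k * k) k) ⟩
    x % k + suc (x / k) * k ≤⟨ ℕₚ.+-monoʳ-≤ (x % k) (ℕₚ.*-monoˡ-≤ k quotient<) ⟩
    x % k + p / k * k       ≡⟨ cong (_+ p / k * k) p≡x ⟨
    p % k + p / k * k       ≡⟨ m≡m%n+[m/n]*n p k ⟨
    p                       ∎
    where
    open ℕₚ.≤-Reasoning
    quotient< : x / k < p / k
    quotient< = ℕₚ.≰⇒> λ p/k≤x/k → ℕₚ.<⇒≱ x<p (begin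
      p                 ≡⟨ m≡m%n+[m/n]*n p k ⟩
      p % k + p / k * k ≤⟨ ℕₚ.+-mono-≤ (ℕₚ.≤-reflexive p≡x) (ℕₚ.*-monoˡ-≤ k p/k≤x/k) ⟩
      x % k + x / k * k ≡⟨ m≡m%n+[m/n]*n x k ⟨
      x                 ∎)

  a<k : a < k
  a<k = ℕₚ.<-≤-trans a<b b≤k

  ≡a[k]⇒a≤ : ∀ {p} → p % k ≡ a % k → a ≤ p
  ≡a[k]⇒a≤ {p} p≡a with ℕₚ.<-cmp p a
  ... | tri< p<a _ _ = contradiction (ℕₚ.≤-trans (ℕₚ.m≤n+m k p) (congruent-<⇒+k≤ (sym p≡a) p<a)) (ℕₚ.<⇒≱ a<k)
  ... | tri≈ _ refl _ = ℕₚ.≤-refl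
  ... | tri> _ _ a<p = ℕₚ.<⇒≤ a<p

  ≡b[k]⇒b≤ : ∀ {p} → 1 ≤ p → p % k ≡ b % k → b ≤ p
  ≡b[k]⇒b≤ {p} 1≤p p≡b with ℕₚ.<-cmp p b
  ... | tri< p<b _ _ = contradiction (ℕₚ.≤-trans (ℕₚ.+-monoˡ-≤ k 1≤p) (congruent-<⇒+k≤ (sym p≡b) p<b)) (ℕₚ.<⇒≱ (s≤s b≤k))
  ... | tri≈ _ refl _ = ℕₚ.≤-refl
  ... | tri> _ _ b<p = ℕₚ.<⇒≤ b<p

  a≢b[k] : ¬ a % k ≡ b % k
  a≢b[k] a≡b = ℕₚ.<⇒≱ a<b (≡b[k]⇒b≤ 1≤a a≡b)

  δ-≡a : ∀ p → p % k ≡ a % k → δ p ≡ 0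
  δ-≡a p p≡a with p % k ℕ.≟ b % k
  ... | yes p≡b = contradiction (trans (sym p≡a) p≡b) a≢b[k]
  ... | no  _   = refl

  δ-≡b : ∀ p → p % k ≡ b % k → δ p ≡ 1
  δ-≡b p p≡b with p % k ℕ.≟ b % k
  ... | yes _   = refl
  ... | no  p≢b = contradiction p≡b p≢b

  δ≤1 : ∀ p → δ p ≤ 1
  δ≤1 p with p % k ℕ.≟ b % k
  ... | yes _ = ℕₚ.≤-refl
  ... | no  _ = z≤n

  PartOK⇒k< : ∀ {p} → PartOK a b k p → ¬ p ≡ a → ¬ p ≡ b → k < p
  PartOK⇒k< {p} (_ , inj₁ p≡a) p≢a _ =
    ℕₚ.≤-trans (ℕₚ.+-monoˡ-≤ k 1≤a) (congruent-<⇒+k≤ p≡a (ℕₚ.≤∧≢⇒< (≡a[k]⇒a≤ p≡a) (p≢a ∘ sym)))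
  PartOK⇒k< {p} (1≤p , inj₂ p≡b) _ p≢b =
    ℕₚ.≤-trans (ℕₚ.+-monoˡ-≤ k (ℕₚ.≤-trans 1≤a (ℕₚ.<⇒≤ a<b)))
               (congruent-<⇒+k≤ p≡b (ℕₚ.≤∧≢⇒< (≡b[k]⇒b≤ 1≤p p≡b) (p≢b ∘ sym)))

  -- r is ≡ a or b (mod k) and exceeds b + k, so r ≥ a + 2k.
  above-b : ∀ {r} → PartOK a b k r → GapOK a b k r b → k + k < r
  above-b {r} (_ , inj₁ r≡a) gap = begin-strict
    k + k       <⟨ ℕₚ.+-monoʳ-< k (ℕₚ.m<n+m k 1≤a) ⟩
    k + (a + k) ≡⟨ ℕₚ.+-comm k (a + k) ⟩
    a + k + k   ≤⟨ congruent-<⇒+k≤ (trans r≡a (sym ([m+n]%n≡m%n a k))) a+k<r ⟩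
    r           ∎
    where
    open ℕₚ.≤-Reasoning
    a+k<r : a + k < r
    a+k<r = ℕₚ.<-≤-trans (ℕₚ.+-monoˡ-< k a<b) (ℕₚ.≤-trans (ℕₚ.m≤m+n (b + k) (δ r)) gap)
  above-b {r} (_ , inj₂ r≡b) gap = begin-strict
    k + k       <⟨ ℕₚ.+-monoʳ-< k (ℕₚ.m<n+m k 1≤a) ⟩
    k + (a + k) ≤⟨ ℕₚ.+-monoʳ-≤ k (ℕₚ.+-monoˡ-≤ k (ℕₚ.<⇒≤ a<b)) ⟩
    k + (b + k) ≡⟨ ℕₚ.+-comm k (b + k) ⟩
    b + k + k   ≤⟨ congruent-<⇒+k≤ (trans r≡b (sym ([m+n]%n≡m%n b k))) b+k<r ⟩
    r           ∎
    where
    open ℕₚ.≤-Reasoning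
    b+k<r : b + k < r
    b+k<r = ℕₚ.≤-trans (ℕₚ.≤-reflexive (trans (ℕₚ.+-comm 1 (b + k)) (cong (b + k +_) (sym (δ-≡b r r≡b))))) gap

  -- ℓa a b k and ℓb a b k are countMod (a % k) and countMod (b % k) by definition.
  countMod : ℕ → List ℕ → ℕ
  countMod r π = length (filter (λ p → p % k ℕ.≟ r) π)

  countMod-∷-≡ : ∀ {r} p π → p % k ≡ r → countMod r (p ∷ π) ≡ suc (countMod r π)
  countMod-∷-≡ {r} p π p≡r = cong length (Listₚ.filter-accept (λ q → q % k ℕ.≟ r) {p} {π} p≡r)

  countMod-∷-≢ : ∀ {r} p π → ¬ p % k ≡ r → countMod r (p ∷ π) ≡ countMod r π
  countMod-∷-≢ {r} p π p≢r = cong length (Listₚ.filter-reject (λ q → q % k ℕ.≟ r) {p} {π} p≢r)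

  countMod-++ : ∀ r xs ys → countMod r (xs ++ ys) ≡ countMod r xs + countMod r ys
  countMod-++ r xs ys = trans (cong length (Listₚ.filter-++ (λ q → q % k ℕ.≟ r) xs ys))
                           (Listₚ.length-++ (filter (λ q → q % k ℕ.≟ r) xs))

  countMod-shift : ∀ {s} → k ∣ s → ∀ r ρ → countMod r (map (s +_) ρ) ≡ countMod r ρ
  countMod-shift k∣s r []      = refl
  countMod-shift {s} k∣s r (p ∷ ρ) with p % k ℕ.≟ r
  ... | yes p≡r = begin
    countMod r (s + p ∷ map (s +_) ρ)  ≡⟨ countMod-∷-≡ (s + p) (map (s +_) ρ) (trans (%-remove-+ˡ p k∣s) p≡r) ⟩
    suc (countMod r (map (s +_) ρ))    ≡⟨ cong suc (countMod-shift k∣s r ρ) ⟩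
    suc (countMod r ρ)                 ≡⟨ countMod-∷-≡ p ρ p≡r ⟨
    countMod r (p ∷ ρ)                 ∎
    where open ≡-Reasoning
  ... | no  p≢r = begin
    countMod r (s + p ∷ map (s +_) ρ)  ≡⟨ countMod-∷-≢ (s + p) (map (s +_) ρ) (p≢r ∘ trans (sym (%-remove-+ˡ p k∣s))) ⟩
    countMod r (map (s +_) ρ)          ≡⟨ countMod-shift k∣s r ρ ⟩
    countMod r ρ                       ≡⟨ countMod-∷-≢ p ρ p≢r ⟨
    countMod r (p ∷ ρ)                 ∎
    where open ≡-Reasoning

  length≡ℓa+ℓb : ∀ {π} → All (PartOK a b k) π → length π ≡ ℓa a b k π + ℓb a b k π
  length≡ℓa+ℓb []                      = refl
  length≡ℓa+ℓb {p ∷ π} ((_ , inj₁ p≡a) ∷ oks) = begin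
    suc (length π)                           ≡⟨ cong suc (length≡ℓa+ℓb oks) ⟩
    suc (ℓa a b k π + ℓb a b k π)
      ≡⟨ cong₂ _+_ (countMod-∷-≡ p π p≡a) (countMod-∷-≢ p π (a≢b[k] ∘ trans (sym p≡a))) ⟨
    ℓa a b k (p ∷ π) + ℓb a b k (p ∷ π)       ∎
    where open ≡-Reasoning
  length≡ℓa+ℓb {p ∷ π} ((_ , inj₂ p≡b) ∷ oks) = begin
    suc (length π)                           ≡⟨ cong suc (length≡ℓa+ℓb oks) ⟩
    suc (ℓa a b k π + ℓb a b k π)             ≡⟨ ℕₚ.+-suc (ℓa a b k π) (ℓb a b k π) ⟨
    ℓa a b k π + suc (ℓb a b k π)
      ≡⟨ cong₂ _+_ (countMod-∷-≢ p π (a≢b[k] ∘ λ p≡a → trans (sym p≡a) p≡b)) (countMod-∷-≡ p π p≡b) ⟨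
    ℓa a b k (p ∷ π) + ℓb a b k (p ∷ π)       ∎
    where open ≡-Reasoning

  D⇒PartOK : ∀ {π} → D π → All (PartOK a b k) π
  D⇒PartOK nil            = []
  D⇒PartOK (one ok)       = ok ∷ []
  D⇒PartOK (cons ok _ d)  = ok ∷ D⇒PartOK d

  module Shift {s} (k∣s : k ∣ s) where

    shift-≡[k] : ∀ p → (s + p) % k ≡ p % k
    shift-≡[k] p = %-remove-+ˡ p k∣s

    δ-shift : ∀ p → δ (s + p) ≡ δ p
    δ-shift p = cong (λ r → if ⌊ r ℕ.≟ b % k ⌋ then 1 else 0) (shift-≡[k] p)

    PartOK-shift : ∀ {p} → PartOK a b k p → PartOK a b k (s + p)
    PartOK-shift {p} (1≤p , residue) =
      ℕₚ.≤-trans 1≤p (ℕₚ.m≤n+m p s) , Sum.map (trans (shift-≡[k] p)) (trans (shift-≡[k] p)) residue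

    PartOK-unshift : ∀ {p} → 1 ≤ p → PartOK a b k (s + p) → PartOK a b k p
    PartOK-unshift {p} 1≤p (_ , residue) =
      1≤p , Sum.map (trans (sym (shift-≡[k] p))) (trans (sym (shift-≡[k] p))) residue

    regroup : ∀ r d → s + r + k + d ≡ s + (r + k + d)
    regroup r d = arithmetic s r k d
      where
      arithmetic : ∀ s r k d → s + r + k + d ≡ s + (r + k + d)
      arithmetic = solve-∀

    GapOK-shift : ∀ {p r} → GapOK a b k p r → GapOK a b k (s + p) (s + r)
    GapOK-shift {p} {r} gap = begin
      s + r + k + δ (s + p)   ≡⟨ cong (s + r + k +_) (δ-shift p) ⟩
      s + r + k + δ p         ≡⟨ regroup r (δ p) ⟩
      s + (r + k + δ p)       ≤⟨ ℕₚ.+-monoʳ-≤ s gap ⟩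
      s + p                   ∎
      where open ℕₚ.≤-Reasoning

    GapOK-unshift : ∀ {p r} → GapOK a b k (s + p) (s + r) → GapOK a b k p r
    GapOK-unshift {p} {r} gap = ℕₚ.+-cancelˡ-≤ s (r + k + δ p) p (begin
      s + (r + k + δ p)       ≡⟨ regroup r (δ p) ⟨
      s + r + k + δ p         ≡⟨ cong (s + r + k +_) (δ-shift p) ⟨
      s + r + k + δ (s + p)   ≤⟨ gap ⟩
      s + p                   ∎)
      where open ℕₚ.≤-Reasoning

    D-shift : ∀ {ρ} → D ρ → D (map (s +_) ρ)
    D-shift nil             = nil
    D-shift (one ok)        = one (PartOK-shift ok)
    D-shift (cons ok gap d) = cons (PartOK-shift ok) (GapOK-shift gap) (D-shift d)

    sum-shift : ∀ ρ → sum (map (s +_) ρ) ≡ length ρ * s + sum ρ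
    sum-shift []      = refl
    sum-shift (p ∷ ρ) rewrite sum-shift ρ = arithmetic s p (length ρ) (sum ρ)
      where
      arithmetic : ∀ s p l t → s + p + (l * s + t) ≡ s + l * s + (p + t)
      arithmetic = solve-∀

    sum-shift-D : ∀ {ρ} → D ρ → sum (map (s +_) ρ) ≡ (ℓa a b k ρ + ℓb a b k ρ) * s + sum ρ
    sum-shift-D {ρ} d = trans (sum-shift ρ) (cong (λ l → l * s + sum ρ) (length≡ℓa+ℓb (D⇒PartOK d)))

    unshift : ∀ {p} → PartOK a b k p → s < p → Σ ℕ λ p′ → PartOK a b k p′ × s + p′ ≡ p
    unshift ok s<p with ℕₚ.m≤n⇒∃[o]m+o≡n (ℕₚ.<⇒≤ s<p)
    ... | p′ , refl =
      p′ , PartOK-unshift (ℕₚ.+-cancelˡ-≤ s 1 p′ (ℕₚ.≤-trans (ℕₚ.≤-reflexive (ℕₚ.+-comm s 1)) s<p)) ok , refl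

    GapOK⇒< : ∀ {p r} → GapOK a b k p (s + r) → s < p
    GapOK⇒< {p} {r} gap = ℕₚ.<-≤-trans (ℕₚ.≤-<-trans (ℕₚ.m≤m+n s r) (ℕₚ.m<m+n (s + r) (s≤s z≤n)))
                                      (ℕₚ.≤-trans (ℕₚ.m≤m+n (s + r + k) (δ p)) gap)

    unshift-cons : ∀ {p r ρ} → PartOK a b k p → GapOK a b k p (s + r) → D (r ∷ ρ) →
                   Σ ℕ λ p′ → D (p′ ∷ r ∷ ρ) × s + p′ ≡ p
    unshift-cons ok gap d with unshift ok (GapOK⇒< gap)
    ... | p′ , ok′ , refl = p′ , cons ok′ (GapOK-unshift gap) d , refl

  a+δ≤ : ∀ {r} → PartOK a b k r → a + δ r ≤ r
  a+δ≤ {r} (_ , inj₁ r≡a) =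
    ℕₚ.≤-trans (ℕₚ.≤-reflexive (trans (cong (a +_) (δ-≡a r r≡a)) (ℕₚ.+-identityʳ a))) (≡a[k]⇒a≤ r≡a)
  a+δ≤ {r} (1≤r , inj₂ r≡b) =
    ℕₚ.≤-trans (ℕₚ.≤-reflexive (trans (cong (a +_) (δ-≡b r r≡b)) (ℕₚ.+-comm a 1))) (ℕₚ.<-≤-trans a<b (≡b[k]⇒b≤ 1≤r r≡b))

  GapToLast : List ℕ → ℕ → Set
  GapToLast []           x = ⊤
  GapToLast (p ∷ [])     x = GapOK a b k p x
  GapToLast (p ∷ q ∷ ps) x = GapToLast (q ∷ ps) x

  D-∷ʳ : ∀ {xs x} → D xs → PartOK a b k x → GapToLast xs x → D (xs ∷ʳ x)
  D-∷ʳ nil                            ok _   = one ok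
  D-∷ʳ (one okp)                      ok gap = cons okp gap (one ok)
  D-∷ʳ {_ ∷ _ ∷ _} (cons okp gap′ d)  ok gap = cons okp gap′ (D-∷ʳ d ok gap)

  GapToLast-map : ∀ {x} (f : ℕ → ℕ) → (∀ {r} → PartOK a b k r → GapOK a b k (f r) x) →
                  ∀ {ρ} → D ρ → GapToLast (map f ρ) x
  GapToLast-map f gap nil              = tt
  GapToLast-map f gap (one ok)         = gap ok
  GapToLast-map f gap (cons _ _ d@(one _))      = GapToLast-map f gap d
  GapToLast-map f gap (cons _ _ d@(cons _ _ _)) = GapToLast-map f gap d

  k∣2k : k ∣ k + k
  k∣2k = ∣m∣n⇒∣m+n ∣-refl ∣-refl

  module Shift₁ = Shift {k} ∣-refl
  module Shift₂ = Shift {k + k} k∣2k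

  gap-to-a : ∀ {r} → PartOK a b k r → GapOK a b k (k + r) a
  gap-to-a {r} ok = begin
    a + k + δ (k + r) ≡⟨ cong (a + k +_) (Shift₁.δ-shift r) ⟩
    a + k + δ r       ≡⟨ arithmetic a k (δ r) ⟩
    k + (a + δ r)     ≤⟨ ℕₚ.+-monoʳ-≤ k (a+δ≤ ok) ⟩
    k + r             ∎
    where
    open ℕₚ.≤-Reasoning
    arithmetic : ∀ a k d → a + k + d ≡ k + (a + d)
    arithmetic = solve-∀

  gap-to-b : ∀ {r} → PartOK a b k r → GapOK a b k (k + k + r) b
  gap-to-b {r} (1≤r , _) = begin
    b + k + δ (k + k + r) ≤⟨ ℕₚ.+-monoʳ-≤ (b + k) (δ≤1 (k + k + r)) ⟩
    b + k + 1             ≤⟨ ℕₚ.+-mono-≤ (ℕₚ.+-monoˡ-≤ k b≤k) 1≤r ⟩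
    k + k + r             ∎
    where open ℕₚ.≤-Reasoning

  Piece : Set
  Piece = (List ℕ ⊎ List ℕ) ⊎ List ℕ

  pattern shifted ρ = inj₁ (inj₁ ρ)
  pattern withA ρ   = inj₁ (inj₂ ρ)
  pattern withB ρ   = inj₂ ρ

  body : Piece → List ℕ
  body (shifted ρ) = ρ
  body (withA ρ)   = ρ
  body (withB ρ)   = ρ

  assemble : Piece → List ℕ
  assemble (shifted ρ) = map (k +_) ρ
  assemble (withA ρ)   = map (k +_) ρ ∷ʳ a
  assemble (withB ρ)   = map (k + k +_) ρ ∷ʳ b

  assemble-D : ∀ y → D (body y) → D (assemble y)
  assemble-D (shifted ρ) d = Shift₁.D-shift d
  assemble-D (withA ρ)   d = D-∷ʳ (Shift₁.D-shift d) (1≤a , inj₁ refl) (GapToLast-map (k +_) gap-to-a d)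
  assemble-D (withB ρ)   d =
    D-∷ʳ (Shift₂.D-shift d) (ℕₚ.≤-trans 1≤a (ℕₚ.<⇒≤ a<b) , inj₂ refl) (GapToLast-map (k + k +_) gap-to-b d)

  decompose : ∀ {π} → D π → Σ Piece λ y → D (body y) × assemble y ≡ π
  decompose nil = shifted [] , nil , refl
  decompose (one {p} ok) with p ℕ.≟ a | p ℕ.≟ b
  ... | yes refl | _        = withA [] , nil , refl
  ... | no _     | yes refl = withB [] , nil , refl
  ... | no p≢a   | no p≢b with Shift₁.unshift ok (PartOK⇒k< ok p≢a p≢b)
  ...   | p′ , ok′ , refl = shifted (p′ ∷ []) , one ok′ , refl
  decompose (cons {p} ok gap d) with decompose d
  ... | shifted []      , _  , ()
  ... | shifted (r ∷ ρ) , dρ , refl with Shift₁.unshift-cons ok gap dρ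
  ...   | p′ , dρ′ , refl = shifted (p′ ∷ r ∷ ρ) , dρ′ , refl
  decompose (cons {p} ok gap d)
      | withA []        , _  , refl
      with Shift₁.unshift ok (ℕₚ.<-≤-trans (ℕₚ.m<n+m k 1≤a) (ℕₚ.≤-trans (ℕₚ.m≤m+n (a + k) (δ p)) gap))
  ...   | p′ , ok′ , refl = withA (p′ ∷ []) , one ok′ , refl
  decompose (cons {p} ok gap d)
      | withA (r ∷ ρ)   , dρ , refl with Shift₁.unshift-cons ok gap dρ
  ...   | p′ , dρ′ , refl = withA (p′ ∷ r ∷ ρ) , dρ′ , refl
  decompose (cons {p} ok gap d)
      | withB []        , _  , refl with Shift₂.unshift ok (above-b ok gap)
  ...   | p′ , ok′ , refl = withB (p′ ∷ []) , one ok′ , refl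
  decompose (cons {p} ok gap d)
      | withB (r ∷ ρ)   , dρ , refl with Shift₂.unshift-cons ok gap dρ
  ...   | p′ , dρ′ , refl = withB (p′ ∷ r ∷ ρ) , dρ′ , refl

  k<appended : ∀ {ρ xs x} → D ρ → map (k +_) ρ ≡ xs ∷ʳ x → k < x
  k<appended d eq = proj₂ (Allₚ.∷ʳ⁻ (subst (All (k <_)) eq (Allₚ.map⁺ (All.map (λ (1≤p , _) → ℕₚ.m<m+n k 1≤p) (D⇒PartOK d)))))

  shift-injective : ∀ {s ρ ρ′} → map (s +_) ρ ≡ map (s +_) ρ′ → ρ ≡ ρ′
  shift-injective {s} = Listₚ.map-injective (ℕₚ.+-cancelˡ-≡ s _ _)

  assemble-injective : ∀ y y′ → D (body y) → D (body y′) → assemble y ≡ assemble y′ → y ≡ y′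
  assemble-injective (shifted ρ) (shifted ρ′) _ _ eq = cong shifted (shift-injective eq)
  assemble-injective (withA ρ)   (withA ρ′)   _ _ eq = cong withA (shift-injective (Listₚ.∷ʳ-injectiveˡ _ _ eq))
  assemble-injective (withB ρ)   (withB ρ′)   _ _ eq = cong withB (shift-injective (Listₚ.∷ʳ-injectiveˡ _ _ eq))
  assemble-injective (shifted ρ) (withA ρ′)   d _ eq = contradiction (k<appended d eq) (ℕₚ.<⇒≯ a<k)
  assemble-injective (withA ρ)   (shifted ρ′) _ d eq = contradiction (k<appended d (sym eq)) (ℕₚ.<⇒≯ a<k)
  assemble-injective (shifted ρ) (withB ρ′)   d _ eq = contradiction (k<appended d eq) (ℕₚ.≤⇒≯ b≤k)
  assemble-injective (withB ρ)   (shifted ρ′) _ d eq = contradiction (k<appended d (sym eq)) (ℕₚ.≤⇒≯ b≤k)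
  assemble-injective (withA ρ)   (withB ρ′)   _ _ eq = contradiction (Listₚ.∷ʳ-injectiveʳ (map (k +_) ρ) _ eq) (ℕₚ.<⇒≢ a<b)
  assemble-injective (withB ρ)   (withA ρ′)   _ _ eq = contradiction (Listₚ.∷ʳ-injectiveʳ (map (k + k +_) ρ) _ eq) (ℕₚ.<⇒≢ a<b ∘ sym)

  Stats : ℕ → ℕ → ℕ → List ℕ → Set
  Stats i j n π = ℓa a b k π ≡ i × ℓb a b k π ≡ j × sum π ≡ n

  DPartition : ℕ → ℕ → ℕ → List ℕ → Set
  DPartition i j n π = D π × Stats i j n π

  countMod-∷ʳ-≡ : ∀ {r x} xs → x % k ≡ r → countMod r (xs ∷ʳ x) ≡ suc (countMod r xs)
  countMod-∷ʳ-≡ {r} {x} xs x≡r =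
    trans (countMod-++ r xs (x ∷ [])) (trans (cong (countMod r xs +_) (countMod-∷-≡ x [] x≡r)) (ℕₚ.+-comm (countMod r xs) 1))

  countMod-∷ʳ-≢ : ∀ {r x} xs → ¬ x % k ≡ r → countMod r (xs ∷ʳ x) ≡ countMod r xs
  countMod-∷ʳ-≢ {r} {x} xs x≢r =
    trans (countMod-++ r xs (x ∷ [])) (trans (cong (countMod r xs +_) (countMod-∷-≢ x [] x≢r)) (ℕₚ.+-identityʳ (countMod r xs)))

  sum-∷ʳ : ∀ xs x → sum (xs ∷ʳ x) ≡ x + sum xs
  sum-∷ʳ xs x = trans (sumₚ.sum-++ xs (x ∷ [])) (trans (cong (sum xs +_) (ℕₚ.+-identityʳ x)) (ℕₚ.+-comm (sum xs) x))

  extraA extraB : Piece → ℕ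
  extraA (withA _) = 1
  extraA _         = 0
  extraB (withB _) = 1
  extraB _         = 0

  weight : Piece → ℕ → ℕ → ℕ
  weight (shifted _) = Δ₀
  weight (withA _)   = Δa
  weight (withB _)   = Δb

  assemble-stats : ∀ y → D (body y) →
    let ρ = body y in
    Stats (extraA y + ℓa a b k ρ) (extraB y + ℓb a b k ρ) (weight y (ℓa a b k ρ) (ℓb a b k ρ) + sum ρ) (assemble y)
  assemble-stats (shifted ρ) d =
    countMod-shift ∣-refl (a % k) ρ , countMod-shift ∣-refl (b % k) ρ , Shift₁.sum-shift-D d
  assemble-stats (withA ρ) d =
    trans (countMod-∷ʳ-≡ (map (k +_) ρ) refl) (cong suc (countMod-shift ∣-refl (a % k) ρ)) ,
    trans (countMod-∷ʳ-≢ (map (k +_) ρ) a≢b[k]) (countMod-shift ∣-refl (b % k) ρ) ,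
    trans (sum-∷ʳ (map (k +_) ρ) a) (trans (cong (a +_) (Shift₁.sum-shift-D d)) (sym (ℕₚ.+-assoc a _ (sum ρ))))
  assemble-stats (withB ρ) d =
    trans (countMod-∷ʳ-≢ (map (k + k +_) ρ) (a≢b[k] ∘ sym)) (countMod-shift k∣2k (a % k) ρ) ,
    trans (countMod-∷ʳ-≡ (map (k + k +_) ρ) refl) (cong suc (countMod-shift k∣2k (b % k) ρ)) ,
    trans (sum-∷ʳ (map (k + k +_) ρ) b) (trans (cong (b +_) (Shift₂.sum-shift-D d)) (sym (ℕₚ.+-assoc b _ (sum ρ))))

  Valid : ℕ → ℕ → ℕ → Piece → Set
  Valid i       j       n (shifted ρ) = Δ₀ i j ≤ n × DPartition i j (n ∸ Δ₀ i j) ρ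
  Valid zero    j       n (withA ρ)   = ⊥
  Valid (suc i) j       n (withA ρ)   = Δa i j ≤ n × DPartition i j (n ∸ Δa i j) ρ
  Valid i       zero    n (withB ρ)   = ⊥
  Valid i       (suc j) n (withB ρ)   = Δb i j ≤ n × DPartition i j (n ∸ Δb i j) ρ

  D-body : ∀ {i j n} y → Valid i j n y → D (body y)
  D-body {i}     {j}     (shifted ρ) (_ , d , _) = d
  D-body {suc i} {j}     (withA ρ)   (_ , d , _) = d
  D-body {i}     {suc j} (withB ρ)   (_ , d , _) = d

  size-join : ∀ {w m n} → w ≤ n → m ≡ n ∸ w → w + m ≡ n
  size-join {w} w≤n e = trans (cong (w +_) e) (ℕₚ.m+[n∸m]≡n w≤n)

  size-split : ∀ (W : ℕ → ℕ → ℕ) {i j n ρ} → D ρ → ℓa a b k ρ ≡ i → ℓb a b k ρ ≡ j →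
               W (ℓa a b k ρ) (ℓb a b k ρ) + sum ρ ≡ n → W i j ≤ n × DPartition i j (n ∸ W i j) ρ
  size-split W {i} {j} {ρ = ρ} d refl refl e =
    subst (W i j ≤_) e (ℕₚ.m≤m+n (W i j) (sum ρ)) , d , refl , refl ,
    trans (sym (ℕₚ.m+n∸m≡n (W i j) (sum ρ))) (cong (_∸ W i j) e)

  valid-sound : ∀ {i j n} y → Valid i j n y → DPartition i j n (assemble y)
  valid-sound y valid = assemble-D y (D-body y valid) , stats y valid
    where
    stats : ∀ {i j n} y → Valid i j n y → Stats i j n (assemble y)
    stats {i} {j} (shifted ρ) (le , d , refl , refl , e) =
      let (ea , eb , es) = assemble-stats (shifted ρ) d in ea , eb , trans es (size-join le e)
    stats {suc i} {j} (withA ρ) (le , d , refl , refl , e) =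
      let (ea , eb , es) = assemble-stats (withA ρ) d in ea , eb , trans es (size-join le e)
    stats {i} {suc j} (withB ρ) (le , d , refl , refl , e) =
      let (ea , eb , es) = assemble-stats (withB ρ) d in ea , eb , trans es (size-join le e)

  valid-complete : ∀ {i j n} y → D (body y) → Stats i j n (assemble y) → Valid i j n y
  valid-complete {i}     {j}     {n} (shifted ρ) d (ea , eb , es) =
    let (ea′ , eb′ , es′) = assemble-stats (shifted ρ) d in
    size-split Δ₀ d (trans (sym ea′) ea) (trans (sym eb′) eb) (trans (sym es′) es)
  valid-complete {zero}  {j}     {n} (withA ρ)   d (ea , _ , _) =
    let (ea′ , _ , _) = assemble-stats (withA ρ) d in ℕₚ.1+n≢0 (trans (sym ea′) ea)
  valid-complete {suc i} {j}     {n} (withA ρ)   d (ea , eb , es) =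
    let (ea′ , eb′ , es′) = assemble-stats (withA ρ) d in
    size-split Δa d (ℕₚ.suc-injective (trans (sym ea′) ea)) (trans (sym eb′) eb) (trans (sym es′) es)
  valid-complete {i}     {zero}  {n} (withB ρ)   d (_ , eb , _) =
    let (_ , eb′ , _) = assemble-stats (withB ρ) d in ℕₚ.1+n≢0 (trans (sym eb′) eb)
  valid-complete {i}     {suc j} {n} (withB ρ)   d (ea , eb , es) =
    let (ea′ , eb′ , es′) = assemble-stats (withB ρ) d in
    size-split Δb d (trans (sym ea′) ea) (ℕₚ.suc-injective (trans (sym eb′) eb)) (trans (sym es′) es)

  PartOK-irrelevant : ∀ {p} → Irrelevant (PartOK a b k p)
  PartOK-irrelevant {p} (1≤p , r) (1≤p′ , r′) = cong₂ _,_ (ℕₚ.≤-irrelevant 1≤p 1≤p′) (residue-irrelevant r r′)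
    where
    residue-irrelevant : Irrelevant (p % k ≡ a % k ⊎ p % k ≡ b % k)
    residue-irrelevant (inj₁ e) (inj₁ e′) = cong inj₁ (ℕₚ.≡-irrelevant e e′)
    residue-irrelevant (inj₂ e) (inj₂ e′) = cong inj₂ (ℕₚ.≡-irrelevant e e′)
    residue-irrelevant (inj₁ e) (inj₂ e′) = contradiction (trans (sym e) e′) a≢b[k]
    residue-irrelevant (inj₂ e) (inj₁ e′) = contradiction (trans (sym e′) e) a≢b[k]

  D-irrelevant : ∀ {π} → Irrelevant (D π)
  D-irrelevant nil              nil                 = refl
  D-irrelevant (one ok)         (one ok′)           = cong one (PartOK-irrelevant ok ok′)
  D-irrelevant (cons ok gap d)  (cons ok′ gap′ d′)  =
    cong₂ (λ ok (gap , d) → cons ok gap d) (PartOK-irrelevant ok ok′)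
          (cong₂ _,_ (ℕₚ.≤-irrelevant gap gap′) (D-irrelevant d d′))

  DPartition-irrelevant : ∀ {i j n π} → Irrelevant (DPartition i j n π)
  DPartition-irrelevant =
    ×-irrelevant D-irrelevant (×-irrelevant ℕₚ.≡-irrelevant (×-irrelevant ℕₚ.≡-irrelevant ℕₚ.≡-irrelevant))

  Valid-irrelevant : ∀ {i j n} y → Irrelevant (Valid i j n y)
  Valid-irrelevant {i}     {j}     (shifted ρ) = ×-irrelevant ℕₚ.≤-irrelevant DPartition-irrelevant
  Valid-irrelevant {suc i} {j}     (withA ρ)   = ×-irrelevant ℕₚ.≤-irrelevant DPartition-irrelevant
  Valid-irrelevant {i}     {suc j} (withB ρ)   = ×-irrelevant ℕₚ.≤-irrelevant DPartition-irrelevant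

  pieces↔partitions : ∀ i j n → Σ Piece (Valid i j n) ↔ Σ (List ℕ) (DPartition i j n)
  pieces↔partitions i j n = Σ↔Σ-injective-onto DPartition-irrelevant (Valid-irrelevant _) assemble (valid-sound _)
    (λ {y} {y′} v v′ → assemble-injective y y′ (D-body y v) (D-body y′ v′))
    (λ (d , stats) → let (y , dρ , eq) = decompose d in
                     y , valid-complete y dρ (subst (Stats i j n) (sym eq) stats) , eq)

  coeff₀₀≋𝟏 : coeff 0 0 ≋ 𝟏
  coeff₀₀≋𝟏 = ≋-trans (⊠-identityʳ (q^ 0 ⊠ 𝟏)) (q^0-identityˡ 𝟏)

  Counted : ℕ → ℕ → ℕ → Set
  Counted i j n = Counts (coeff i j n) (Σ (List ℕ) (DPartition i j n))

  CountedBelow : ℕ → Set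
  CountedBelow n = ∀ {m} → m < n → ∀ i j → Counted i j m

  count-shifted : ∀ {i j n} → CountedBelow n → ∀ s → 1 ≤ s →
    Counts ((q^ s ⊠ coeff i j) n) (Σ (List ℕ) λ ρ → s ≤ n × DPartition i j (n ∸ s) ρ)
  count-shifted {i} {j} {n} below s 1≤s = by-cases (s ℕ.≤? n)
    where
    by-cases : Dec (s ≤ n) → Counts ((q^ s ⊠ coeff i j) n) (Σ (List ℕ) λ ρ → s ≤ n × DPartition i j (n ∸ s) ρ)
    by-cases (yes s≤n) = counts-≡ (sym (q^-shift s (coeff i j) n s≤n))
      (counts-↔ (Σ-↔-×-inhabited ℕₚ.≤-irrelevant s≤n) (below (ℕₚ.∸-monoʳ-< 1≤s s≤n) i j))
    by-cases (no s≰n)  = counts-≡ (sym (q^-shift-< s (coeff i j) n (ℕₚ.≰⇒> s≰n))) (counts-empty (s≰n ∘ proj₁ ∘ proj₂))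

  count-withA : ∀ {n} → CountedBelow n → ∀ i j → Counts (aTerm i j n) (Σ (List ℕ) λ ρ → Valid i j n (withA ρ))
  count-withA         below zero    j = counts-empty proj₂
  count-withA {n} below (suc i) j = count-shifted {i} {j} {n} below (Δa i j) (ℕₚ.≤-trans 1≤a (ℕₚ.m≤m+n a _))

  count-withB : ∀ {n} → CountedBelow n → ∀ i j → Counts (bTerm i j n) (Σ (List ℕ) λ ρ → Valid i j n (withB ρ))
  count-withB         below i zero    = counts-empty proj₂
  count-withB {n} below i (suc j) =
    count-shifted {i} {j} {n} below (Δb i j) (ℕₚ.≤-trans (ℕₚ.<⇒≤ (ℕₚ.≤-<-trans 1≤a a<b)) (ℕₚ.m≤m+n b _))

  count-nonempty : ∀ {n} → CountedBelow n → ∀ i j → 1 ≤ i + j → Counted i j n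
  count-nonempty {n} below i j 1≤i+j =
    counts-≡ (sym (at (coeff-recurrence i j) n))
      (counts-↔ (pieces↔partitions i j n ↔-∘ ↔-sym (Σ-distribʳ-⊎³ (Valid i j n)))
        (counts-⊎ (counts-⊎ (count-shifted {i} {j} {n} below (Δ₀ i j) (ℕₚ.≤-trans 1≤i+j (ℕₚ.m≤m*n (i + j) k)))
                            (count-withA below i j))
                  (count-withB below i j)))

  only-empty : ∀ {n π} → DPartition 0 0 n π → π ≡ [] × n ≡ 0
  only-empty {π = []}    (_ , _ , _ , refl) = refl , refl
  only-empty {π = p ∷ π} (d , ℓa≡0 , ℓb≡0 , _) =
    contradiction (trans (length≡ℓa+ℓb (D⇒PartOK d)) (cong₂ _+_ ℓa≡0 ℓb≡0)) ℕₚ.1+n≢0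

  count-empty : ∀ n → Counted 0 0 n
  count-empty zero    = counts-≡ (sym (at coeff₀₀≋𝟏 0)) (counts-unique empty is-empty)
    where
    empty : Σ (List ℕ) (DPartition 0 0 0)
    empty = [] , nil , refl , refl , refl
    is-empty : ∀ x → empty ≡ x
    is-empty (π , p) with only-empty p
    ... | refl , _ = cong ([] ,_) (DPartition-irrelevant (proj₂ empty) p)
  count-empty (suc n) =
    counts-≡ (sym (at coeff₀₀≋𝟏 (suc n))) (counts-empty (λ (_ , p) → ℕₚ.1+n≢0 (proj₂ (only-empty p))))

  count : ∀ n i j → Counted i j n
  count = <-rec (λ n → ∀ i j → Counted i j n) λ where
    n below zero    zero    → count-empty n
    n below zero    (suc j) → count-nonempty below zero (suc j) (s≤s z≤n)
    n below (suc i) j       → count-nonempty below (suc i) j (s≤s z≤n)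

open import Data.Integer using (+_)

mainTheorem5 : (a b k : ℕ) .{{_ : NonZero k}} → 1 ≤ a → a < b → b ≤ k →
    (i j n : ℕ) → ∃ λ c →
      (Fin c ↔ Σ (List ℕ) (λ π → InD a b k π × ℓa a b k π ≡ i × ℓb a b k π ≡ j × sum π ≡ n))
      × (∃ λ N → (M : ℕ) → N ≤ M → midPartial a b k M i j n ≡ + c)
      × (∃ λ N → (M : ℕ) → N ≤ M → rightPartial a b k M i j n ≡ + c)
mainTheorem5 a b zero      1≤a a<b b≤0 i j n = contradiction (ℕₚ.<-≤-trans a<b b≤0) ℕₚ.n≮0
mainTheorem5 a b (suc k′) 1≤a a<b b≤k i j n =
  let (c , coeff≡c , bijection) = Partitions.count k′ a b 1≤a a<b b≤k n i j in
  c , bijection ,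
  (suc (i ℕ.+ j)       , λ M i+j<M   → trans (midPartial-coeff (ℕₚ.<⇒≤ a<b) i j n M i+j<M) coeff≡c) ,
  (suc (n ℕ.+ i ℕ.+ j) , λ M n+i+j<M → trans (rightPartial-coeff i j n M n+i+j<M) coeff≡c)
  where open SeriesSides k′ a b using (midPartial-coeff; rightPartial-coeff)
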